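{- Let $k$ be a positive odd integer, $G=\langle x,y:~x^{4k}=y^2=e,~yxy=x^{ -1}\rangle$, $A_1=\langle x^4\rangle$, $Z=x^2A_1\cup y(A_1\setminus\{x^{2(k-1)}\})\cup\{yx^{2k-1},yx^{ -2},yx^{ -1}\}$ and $\Sigma=\mathrm{Cay}(G,Z)$. Then $\Sigma$ is a strictly Deza graph with parameters $(8k,2(k+1),2(k-1),2)$, i.e. $\Sigma$ is $2(k+1)$-regular on $8k$ vertices and every pair of distinct vertices has either $2(k-1)$ or $2$ common neighbours.
   Context: $\mathrm{Cay}(G,S)$ has vertex set $G$ and edges $\{g,sg\}$, $s\in S$. A $k$-regular graph is a Deza graph if there are nonnegative integers $a,b$ such that every pair of distinct vertices has either $a$ or $b$ common neighbours; it is strictly Deza if it is moreover not strongly regular and has diameter $2$. -}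

module Defs where

open import Data.Bool using (Bool; true; false; _xor_; if_then_else_)
open import Data.Nat using (ℕ; zero; suc; _+_; _*_; _∸_; NonZero)
open import Data.Nat.Properties using (m*n≢0)
open import Data.Fin using (Fin; toℕ) renaming (_≟_ to _≟F_)
open import Data.Fin.Properties using () 
open import Data.Nat.DivMod using (_mod_)
open import Data.List using (List; []; _∷_; _++_; map; filter; length; allFin; upTo; concatMap)
open import Data.List.Relation.Unary.Any using (Any; any?)
open import Data.Product using (_×_; _,_; Σ; ∃; ∃-syntax)
open import Data.Product.Properties using (≡-dec)
open import Data.Sum using (_⊎_)
open import Data.Sum.Relation.Unary.All using ()
open import Relation.Nullary using (¬_; Dec)
open import Relation.Nullary.Decidable using (_⊎-dec_; _×-dec_; ¬?)
open import Relation.Binary.PropositionalEquality using (_≡_; _≢_)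
import Data.Bool.Properties as BP

record FinGraph : Set₁ where
  field
    V        : Set
    vertices : List V                    -- enumeration of all vertices (each once)
    Adj      : V → V → Set
    adj?     : ∀ u v → Dec (Adj u v)

module _ (Γ : FinGraph) where
  open FinGraph Γ

  order : ℕ
  order = length vertices

  degree : V → ℕ
  degree v = length (filter (adj? v) vertices)

  common : V → V → ℕ
  common u v = length (filter (λ w → adj? u w ×-dec adj? v w) vertices)

  Regular : ℕ → Set
  Regular d = ∀ v → degree v ≡ d

  DezaWith : ℕ → ℕ → ℕ → ℕ → Set
  DezaWith n d a b = order ≡ n × Regular d
    × (∀ u v → u ≢ v → common u v ≡ a ⊎ common u v ≡ b)

  StronglyRegular : Set
  StronglyRegular = ∃[ d ] ∃[ l ] ∃[ m ] (Regular d
    × (∀ u v → u ≢ v → Adj u v → common u v ≡ l)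
    × (∀ u v → u ≢ v → ¬ Adj u v → common u v ≡ m))

  Diameter2 : Set
  Diameter2 = (∀ u v → u ≢ v → Adj u v ⊎ ∃[ w ] (Adj u w × Adj w v))
    × ∃[ u ] ∃[ v ] (u ≢ v × ¬ Adj u v)

  StrictlyDezaWith : ℕ → ℕ → ℕ → ℕ → Set
  StrictlyDezaWith n d a b = DezaWith n d a b × ¬ StronglyRegular × Diameter2

-- The group G = ⟨x, y : x^(4k) = y^2 = e, y x y = x^(-1)⟩ of order 8k,
-- elements in normal form x^i (false , i) and y x^i (true , i), i ∈ ℤ/4k.

module Dihedral (k : ℕ) .{{_ : NonZero k}} where

  N : ℕ
  N = 4 * k

  instance
    N≢0 : NonZero N
    N≢0 = m*n≢0 4 k

  G : Set
  G = Bool × Fin N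

  _≟G_ : (g h : G) → Dec (g ≡ h)
  _≟G_ = ≡-dec BP._≟_ _≟F_

  modN : ℕ → Fin N
  modN a = a mod N

  e x y : G
  e = false , modN 0
  x = false , modN 1
  y = true  , modN 0

  -- (y^a x^i)(y^b x^j) = y^(a+b) x^(j-i) if b = 1, y^(a+b) x^(i+j) if b = 0
  _·_ : G → G → G
  (a , i) · (b , j) =
    (a xor b , (if b then modN (toℕ j + (N ∸ toℕ i)) else modN (toℕ i + toℕ j)))

  _⁻¹ : G → G
  (false , i) ⁻¹ = false , modN (N ∸ toℕ i)
  (true  , i) ⁻¹ = true  , i

  _^_ : G → ℕ → G
  g ^ zero  = e
  g ^ suc n = g · (g ^ n)

  elements : List G
  elements = map (false ,_) (allFin N) ++ map (true ,_) (allFin N)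

  -- A₁ = ⟨x⁴⟩ = {x^(4j) : 0 ≤ j < k}  (x⁴ has order k)
  A₁ : List G
  A₁ = map (λ j → (x ^ 4) ^ j) (upTo k)

  Z : List G
  Z = map (λ a → (x ^ 2) · a) A₁
   ++ map (λ a → y · a) (filter (λ a → ¬? (a ≟G (x ^ (2 * (k ∸ 1))))) A₁)
   ++ (y · (x ^ (2 * k ∸ 1))) ∷ (y · ((x ^ 2) ⁻¹)) ∷ (y · (x ⁻¹)) ∷ []

  CayAdj : List G → G → G → Set
  CayAdj S g h = Any (λ s → h ≡ s · g) S ⊎ Any (λ s → g ≡ s · h) S

  Cay : List G → FinGraph
  Cay S = record
    { V = G ; vertices = elements ; Adj = CayAdj S
    ; adj? = λ g h → any? (λ s → h ≟G (s · g)) S ⊎-dec any? (λ s → g ≟G (s · h)) S }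

  Σ-graph : FinGraph
  Σ-graph = Cay Z

{-# OPTIONS --safe #-}
module Submission where

-- Write the elements of G as x^i and y x^i with i ∈ ℤ/4k. Then x^i ∈ Z iff i ≡ 2 (mod 4), and
-- y x^i ∈ Z iff i ∈ Z₁ = {4j : 4j ≠ 2(k-1)} ∪ {2k-1, -2, -1}; as k is odd, Z₁ contains all of
-- residue class 0 mod 4 but 2(k-1), and exactly one point of each other class.
-- Translating and reflecting ℤ/4k, two distinct vertices of the same type with index difference t
-- have |Z₀ ∩ (Z₀ - t)| + |Z₁ ∩ (Z₁ - t)| common neighbours, and vertices of different types
-- 2·|{j ∈ Z₁ : t - j ∈ Z₀}|. Counting class by class mod 4, this is 2(k-1) when t ≡ 0 (same type)
-- or t ≡ 2 (different types), and 2 otherwise. Both values occur on edges and 2(k-1) ≡ 0 ≢ 2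
-- (mod 4), so Σ is not strongly regular; and a pair without common neighbours only occurs for
-- k = 1, where it is adjacent.

open import Data.Bool using (Bool; true; false; _∧_; not; _xor_) renaming (_≟_ to _≟ᵇ_)
open import Data.Bool.Properties using (∧-identityʳ; ∧-zeroʳ; ∧-comm; xor-identityʳ; xor-comm; not-involutive; not-¬)
open import Data.Empty using (⊥; ⊥-elim)
open import Data.Fin using (Fin; toℕ; fromℕ<) renaming (zero to fzero; suc to fsuc)
open import Data.Fin.Properties using (toℕ-fromℕ<; toℕ-injective; toℕ<n)
open import Data.List using (List; []; _∷_; _++_; map; filter; length; tabulate; allFin)
open import Data.List.Membership.Propositional using (_∈_; find; lose)
open import Data.List.Membership.Propositional.Properties
  using (∈-++⁻; ∈-++⁺ˡ; ∈-++⁺ʳ; ∈-map⁻; ∈-map⁺; ∈-filter⁻; ∈-filter⁺; ∈-upTo⁺; ∈-upTo⁻)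
open import Data.List.Properties using (filter-++; length-++; map-tabulate; length-map; length-tabulate)
open import Data.List.Relation.Unary.Any using (here; there)
open import Data.Nat using (ℕ; zero; suc; _+_; _*_; _∸_; _≤_; _<_; z≤n; s≤s; _%_; _/_; NonZero)
open import Data.Nat.DivMod
open import Data.Nat.Divisibility using (_∣_; divides)
open import Data.Nat.Properties
open import Algebra.Properties.CommutativeSemigroup +-commutativeSemigroup using (interchange; xy∙z≈xz∙y)
open import Data.Nat.Tactic.RingSolver using (solve-∀)
open import Data.Product using (∃; _×_; _,_; proj₁; proj₂)
open import Data.Sum using (_⊎_; inj₁; inj₂; [_,_]′; swap)
open import Function using (_∘_; const; mk⇔)
open import Relation.Binary using (Setoid; IsEquivalence)
open import Relation.Binary.PropositionalEquality
open import Relation.Nullary using (¬_; Dec; does; yes; no)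
open import Relation.Nullary.Decidable using (does-⇔; dec-true; dec-false; map′; ¬?; _×-dec_)
open import Relation.Unary using (Pred; Decidable)
open import Defs

𝟙 : Bool → ℕ
𝟙 true  = 1
𝟙 false = 0

𝟙-not : ∀ b → 𝟙 b + 𝟙 (not b) ≡ 1
𝟙-not true  = refl
𝟙-not false = refl

count : ℕ → (ℕ → Bool) → ℕ
count zero    f = 0
count (suc n) f = 𝟙 (f 0) + count n (f ∘ suc)

count-cong : ∀ n {f g} → (∀ {i} → i < n → f i ≡ g i) → count n f ≡ count n g
count-cong zero    eq = refl
count-cong (suc n) eq = cong₂ _+_ (cong 𝟙 (eq (s≤s z≤n))) (count-cong n (λ i<n → eq (s≤s i<n)))

count-congᵉ : ∀ n {f g} → (∀ i → f i ≡ g i) → count n f ≡ count n g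
count-congᵉ n eq = count-cong n (λ {i} _ → eq i)

count-false : ∀ n → count n (const false) ≡ 0
count-false zero    = refl
count-false (suc n) = count-false n

count-true : ∀ n → count n (const true) ≡ n
count-true zero    = refl
count-true (suc n) = cong suc (count-true n)

count-snoc : ∀ n (f : ℕ → Bool) → count (suc n) f ≡ count n f + 𝟙 (f n)
count-snoc zero    f = +-comm (𝟙 (f 0)) 0
count-snoc (suc n) f = begin
  𝟙 (f 0) + count (suc n) (f ∘ suc)        ≡⟨ cong (𝟙 (f 0) +_) (count-snoc n (f ∘ suc)) ⟩
  𝟙 (f 0) + (count n (f ∘ suc) + 𝟙 (f (suc n))) ≡⟨ +-assoc (𝟙 (f 0)) _ _ ⟨
  count (suc n) f + 𝟙 (f (suc n))          ∎
  where open ≡-Reasoning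

count-rotate : ∀ n (f : ℕ → Bool) → f n ≡ f 0 → count n (f ∘ suc) ≡ count n f
count-rotate n f fn≡f0 = +-cancelʳ-≡ (𝟙 (f 0)) _ _ (begin
  count n (f ∘ suc) + 𝟙 (f 0) ≡⟨ +-comm _ (𝟙 (f 0)) ⟩
  count (suc n) f             ≡⟨ count-snoc n f ⟩
  count n f + 𝟙 (f n)         ≡⟨ cong (λ b → count n f + 𝟙 b) fn≡f0 ⟩
  count n f + 𝟙 (f 0)         ∎)
  where open ≡-Reasoning

count-translate : ∀ n (f : ℕ → Bool) c → (∀ i → f (n + i) ≡ f i) → count n (λ i → f (i + c)) ≡ count n f
count-translate n f zero    periodic = count-congᵉ n (λ i → cong f (+-identityʳ i))
count-translate n f (suc c) periodic = begin
  count n (λ i → f (i + suc c)) ≡⟨ count-congᵉ n (λ i → cong f (+-suc i c)) ⟩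
  count n (λ i → f (suc i + c)) ≡⟨ count-rotate n (λ i → f (i + c)) (periodic c) ⟩
  count n (λ i → f (i + c))     ≡⟨ count-translate n f c periodic ⟩
  count n f                     ∎
  where open ≡-Reasoning

count-reverse : ∀ n (f : ℕ → Bool) → count n (λ i → f (n ∸ suc i)) ≡ count n f
count-reverse zero    f = refl
count-reverse (suc n) f = begin
  𝟙 (f n) + count n (λ i → f (n ∸ suc i)) ≡⟨ cong (𝟙 (f n) +_) (count-reverse n f) ⟩
  𝟙 (f n) + count n f                     ≡⟨ +-comm (𝟙 (f n)) (count n f) ⟩
  count n f + 𝟙 (f n)                     ≡⟨ count-snoc n f ⟨
  count (suc n) f                         ∎
  where open ≡-Reasoning

count-reflect : ∀ n (f : ℕ → Bool) → f n ≡ f 0 → count n (λ i → f (n ∸ i)) ≡ count n f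
count-reflect n f fn≡f0 = begin
  count n (λ i → f (n ∸ i))         ≡⟨ count-cong n (λ i<n → cong f (+-∸-assoc 1 i<n)) ⟩
  count n (λ i → f (suc (n ∸ suc i))) ≡⟨ count-reverse n (f ∘ suc) ⟩
  count n (f ∘ suc)                 ≡⟨ count-rotate n f fn≡f0 ⟩
  count n f                         ∎
  where open ≡-Reasoning

count-partition : ∀ n (f g : ℕ → Bool) → count n (λ i → f i ∧ g i) + count n (λ i → not (f i) ∧ g i) ≡ count n g
count-partition zero    f g = refl
count-partition (suc n) f g = begin
  (a + A) + (b + B) ≡⟨ interchange a A b B ⟩
  (a + b) + (A + B) ≡⟨ cong₂ _+_ (split (f 0) (g 0)) (count-partition n (f ∘ suc) (g ∘ suc)) ⟩
  count (suc n) g   ∎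
  where
  open ≡-Reasoning
  a = 𝟙 (f 0 ∧ g 0)
  b = 𝟙 (not (f 0) ∧ g 0)
  A = count n (λ i → f (suc i) ∧ g (suc i))
  B = count n (λ i → not (f (suc i)) ∧ g (suc i))
  split : ∀ x y → 𝟙 (x ∧ y) + 𝟙 (not x ∧ y) ≡ 𝟙 y
  split true  y     = +-identityʳ (𝟙 y)
  split false true  = refl
  split false false = refl

count-at : ∀ n a (g : ℕ → Bool) → a < n → count n (λ i → does (i ≟ a) ∧ g i) ≡ 𝟙 (g a)
count-at (suc n) zero    g _         = trans (cong (𝟙 (g 0) +_) (count-false n)) (+-identityʳ _)
count-at (suc n) (suc a) g (s≤s a<n) = count-at n a (g ∘ suc) a<n

count-≡ : ∀ n {a} → a < n → count n (λ i → does (i ≟ a)) ≡ 1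
count-≡ n {a} a<n = trans (count-congᵉ n (λ i → sym (∧-identityʳ (does (i ≟ a))))) (count-at n a (const true) a<n)

count-≢ : ∀ n {a} → a < n → count n (λ i → not (does (i ≟ a))) + 1 ≡ n
count-≢ n {a} a<n = begin
  count n (λ i → not (does (i ≟ a))) + 1
    ≡⟨ cong₂ _+_ (count-congᵉ n (λ i → sym (∧-identityʳ _))) (sym (count-at n a (const true) a<n)) ⟩
  count n (λ i → not (does (i ≟ a)) ∧ true) + count n (λ i → does (i ≟ a) ∧ true)
    ≡⟨ +-comm (count n (λ i → not (does (i ≟ a)) ∧ true)) _ ⟩
  count n (λ i → does (i ≟ a) ∧ true) + count n (λ i → not (does (i ≟ a)) ∧ true)
    ≡⟨ count-partition n (λ i → does (i ≟ a)) (const true) ⟩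
  count n (const true)
    ≡⟨ count-true n ⟩
  n ∎
  where open ≡-Reasoning

count-by-residue-mod-4 : ∀ k (f : ℕ → Bool) → count (k * 4) f ≡
  count k (λ q → f (q * 4)) + count k (λ q → f (1 + q * 4)) + count k (λ q → f (2 + q * 4)) + count k (λ q → f (3 + q * 4))
count-by-residue-mod-4 zero    f = refl
count-by-residue-mod-4 (suc k) f =
  trans (cong (λ z → 𝟙 (f 0) + (𝟙 (f 1) + (𝟙 (f 2) + (𝟙 (f 3) + z)))) (count-by-residue-mod-4 k (λ i → f (4 + i))))
        (regroup (𝟙 (f 0)) (𝟙 (f 1)) (𝟙 (f 2)) (𝟙 (f 3)) _ _ _ _)
  where
  regroup : ∀ a b c d A B C D → a + (b + (c + (d + (A + B + C + D)))) ≡ (a + A) + (b + B) + (c + C) + (d + D)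
  regroup = solve-∀

length-filter-tabulate : ∀ {A : Set} {ℓ} {P : Pred A ℓ} (P? : Decidable P) n (g : Fin n → A) (f : ℕ → Bool) →
  (∀ i → does (P? (g i)) ≡ f (toℕ i)) → length (filter P? (tabulate g)) ≡ count n f
length-filter-tabulate P? zero    g f eq = refl
length-filter-tabulate P? (suc n) g f eq with does (P? (g fzero)) | f 0 | eq fzero
... | true  | true  | refl = cong suc (length-filter-tabulate P? n (g ∘ fsuc) (f ∘ suc) (eq ∘ fsuc))
... | false | false | refl = length-filter-tabulate P? n (g ∘ fsuc) (f ∘ suc) (eq ∘ fsuc)

does⇒ : ∀ {p} {P : Set p} (P? : Dec P) → does P? ≡ true → P
does⇒ (yes p) _ = p

does[b≟true]≡b : ∀ b → does (b ≟ᵇ true) ≡ b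
does[b≟true]≡b true  = refl
does[b≟true]≡b false = refl

∃-from-length-filter : ∀ {a ℓ} {A : Set a} {P : Pred A ℓ} (P? : Decidable P) xs → length (filter P? xs) ≢ 0 → ∃ P
∃-from-length-filter P? xs nonEmpty with filter P? xs in eq
... | []    = ⊥-elim (nonEmpty refl)
... | w ∷ _ = w , proj₂ (∈-filter⁻ P? {xs = xs} (subst (w ∈_) (sym eq) (here refl)))

[m+n%d]%d≡[m+n]%d : ∀ m n d .{{_ : NonZero d}} → (m + n % d) % d ≡ (m + n) % d
[m+n%d]%d≡[m+n]%d m n d = begin
  (m + n % d) % d             ≡⟨ %-distribˡ-+ m (n % d) d ⟩
  (m % d + n % d % d) % d     ≡⟨ cong (λ r → (m % d + r) % d) (m%n%n≡m%n n d) ⟩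
  (m % d + n % d) % d         ≡⟨ %-distribˡ-+ m n d ⟨
  (m + n) % d                 ∎
  where open ≡-Reasoning

[m%d+n]%d≡[m+n]%d : ∀ m n d .{{_ : NonZero d}} → (m % d + n) % d ≡ (m + n) % d
[m%d+n]%d≡[m+n]%d m n d = begin
  (m % d + n) % d   ≡⟨ cong (_% d) (+-comm (m % d) n) ⟩
  (n + m % d) % d   ≡⟨ [m+n%d]%d≡[m+n]%d n m d ⟩
  (n + m) % d       ≡⟨ cong (_% d) (+-comm n m) ⟩
  (m + n) % d       ∎
  where open ≡-Reasoning

[m+kn+o]%n≡[m+o%n]%n : ∀ m k o n .{{_ : NonZero n}} → (m + k * n + o) % n ≡ (m + o % n) % n
[m+kn+o]%n≡[m+o%n]%n m k o n = begin
  (m + k * n + o) % n   ≡⟨ cong (_% n) (xy∙z≈xz∙y m (k * n) o) ⟩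
  (m + o + k * n) % n   ≡⟨ [m+kn]%n≡m%n (m + o) k n ⟩
  (m + o) % n           ≡⟨ [m+n%d]%d≡[m+n]%d m o n ⟨
  (m + o % n) % n       ∎
  where open ≡-Reasoning

[m+kn]%n≡m : ∀ {m n} k .{{_ : NonZero n}} → m < n → (m + k * n) % n ≡ m
[m+kn]%n≡m {m} {n} k m<n = trans ([m+kn]%n≡m%n m k n) (m<n⇒m%n≡m m<n)

module Modular (N : ℕ) .{{_ : NonZero N}} where

  infix 4 _≋_ _≋?_ _≋ᵇ_
  infixl 6 _⊖_

  record _≋_ (a b : ℕ) : Set where
    constructor mod-≡
    field mod-≡⁻ : a % N ≡ b % N

  open _≋_ public

  ≋-isEquivalence : IsEquivalence _≋_
  ≋-isEquivalence = record
    { refl  = mod-≡ refl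
    ; sym   = λ a≋b → mod-≡ (sym (mod-≡⁻ a≋b))
    ; trans = λ a≋b b≋c → mod-≡ (trans (mod-≡⁻ a≋b) (mod-≡⁻ b≋c))
    }

  ≋-setoid : Setoid _ _
  ≋-setoid = record { isEquivalence = ≋-isEquivalence }

  open Setoid ≋-setoid public using () renaming (refl to ≋-refl; sym to ≋-sym; trans to ≋-trans; reflexive to ≋-reflexive)

  _≋?_ : ∀ a b → Dec (a ≋ b)
  a ≋? b = map′ mod-≡ mod-≡⁻ (a % N ≟ b % N)

  _≋ᵇ_ : ℕ → ℕ → Bool
  a ≋ᵇ b = does (a ≋? b)

  %-≋ : ∀ a → a % N ≋ a
  %-≋ a = mod-≡ (m%n%n≡m%n a N)

  +N-≋ : ∀ a → a + N ≋ a
  +N-≋ a = mod-≡ ([m+n]%n≡m%n a N)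

  +-≋-cong : ∀ {a a' b b'} → a ≋ a' → b ≋ b' → a + b ≋ a' + b'
  +-≋-cong {a} {a'} {b} {b'} (mod-≡ a≋a') (mod-≡ b≋b') = mod-≡ (begin
    (a + b) % N             ≡⟨ %-distribˡ-+ a b N ⟩
    (a % N + b % N) % N     ≡⟨ cong₂ (λ u v → (u + v) % N) a≋a' b≋b' ⟩
    (a' % N + b' % N) % N   ≡⟨ %-distribˡ-+ a' b' N ⟨
    (a' + b') % N           ∎)
    where open ≡-Reasoning

  ≋⇒≡ : ∀ {a b} → a < N → b < N → a ≋ b → a ≡ b
  ≋⇒≡ a<N b<N (mod-≡ a≋b) = trans (sym (m<n⇒m%n≡m a<N)) (trans a≋b (m<n⇒m%n≡m b<N))

  ≋⇒%-≡ : ∀ {a b d} .{{_ : NonZero d}} → d ∣ N → a ≋ b → a % d ≡ b % d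
  ≋⇒%-≡ {a} {b} {d} d∣N (mod-≡ a≋b) = begin
    a % d      ≡⟨ m∣n⇒o%n%m≡o%m d N a d∣N ⟨
    a % N % d  ≡⟨ cong (_% d) a≋b ⟩
    b % N % d  ≡⟨ m∣n⇒o%n%m≡o%m d N b d∣N ⟩
    b % d      ∎
    where open ≡-Reasoning

  ≋ᵇ-cong : ∀ {a a' b b'} → a ≋ a' → b ≋ b' → (a ≋ᵇ b) ≡ (a' ≋ᵇ b')
  ≋ᵇ-cong (mod-≡ a≋a') (mod-≡ b≋b') = cong₂ (λ u v → does (u ≟ v)) a≋a' b≋b'

  _⊖_ : ℕ → ℕ → ℕ
  a ⊖ b = a + (N ∸ b % N)

  ⊖-+ : ∀ a b → a ⊖ b + b ≋ a
  ⊖-+ a b = begin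
    a + (N ∸ b % N) + b        ≡⟨ +-assoc a _ b ⟩
    a + ((N ∸ b % N) + b)      ≈⟨ +-≋-cong (≋-refl {a}) (+-≋-cong (≋-refl {N ∸ b % N}) (%-≋ b)) ⟨
    a + ((N ∸ b % N) + b % N)  ≡⟨ cong (a +_) (m∸n+n≡m (<⇒≤ (m%n<n b N))) ⟩
    a + N                      ≈⟨ +N-≋ a ⟩
    a                          ∎
    where open import Relation.Binary.Reasoning.Setoid ≋-setoid

  +-≋-cancelʳ : ∀ {a b} c → a + c ≋ b + c → a ≋ b
  +-≋-cancelʳ {a} {b} c a+c≋b+c = begin
    a                   ≈⟨ ⊖-+ a c ⟨
    a ⊖ c + c           ≡⟨ xy∙z≈xz∙y a _ c ⟩
    a + c + (N ∸ c % N) ≈⟨ +-≋-cong a+c≋b+c (≋-refl {N ∸ c % N}) ⟩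
    b + c + (N ∸ c % N) ≡⟨ xy∙z≈xz∙y b c _ ⟩
    b ⊖ c + c           ≈⟨ ⊖-+ b c ⟩
    b                   ∎
    where open import Relation.Binary.Reasoning.Setoid ≋-setoid

  ⊖-unique : ∀ {a b d} → d + b ≋ a → d ≋ a ⊖ b
  ⊖-unique {a} {b} d+b≋a = +-≋-cancelʳ b (≋-trans d+b≋a (≋-sym (⊖-+ a b)))

  ⊖-cong : ∀ {a a' b b'} → a ≋ a' → b ≋ b' → a ⊖ b ≋ a' ⊖ b'
  ⊖-cong a≋a' (mod-≡ b≋b') = +-≋-cong a≋a' (mod-≡ (cong (λ r → (N ∸ r) % N) b≋b'))

  +-⊖-cancelʳ : ∀ a b → a + b ⊖ b ≋ a
  +-⊖-cancelʳ a b = ≋-sym (⊖-unique ≋-refl)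

  ⊖-telescope : ∀ a b c → (a ⊖ b) + (b ⊖ c) ≋ a ⊖ c
  ⊖-telescope a b c = ⊖-unique (begin
    (a ⊖ b) + (b ⊖ c) + c    ≡⟨ +-assoc (a ⊖ b) (b ⊖ c) c ⟩
    (a ⊖ b) + ((b ⊖ c) + c)  ≈⟨ +-≋-cong (≋-refl {a ⊖ b}) (⊖-+ b c) ⟩
    a ⊖ b + b                ≈⟨ ⊖-+ a b ⟩
    a                        ∎)
    where open import Relation.Binary.Reasoning.Setoid ≋-setoid

  ⊖-involutive : ∀ a b → a ⊖ (a ⊖ b) ≋ b
  ⊖-involutive a b = ≋-sym (⊖-unique (≋-trans (≋-reflexive (+-comm b (a ⊖ b))) (⊖-+ a b)))

  ⊖-⊖-cancelʳ : ∀ a b c → (a ⊖ c) ⊖ (b ⊖ c) ≋ a ⊖ b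
  ⊖-⊖-cancelʳ a b c = ≋-sym (⊖-unique (⊖-telescope a b c))

  ⊖≋0⇒≋ : ∀ {a b} → a ⊖ b ≋ 0 → a ≋ b
  ⊖≋0⇒≋ {a} {b} a⊖b≋0 = ≋-trans (≋-sym (⊖-+ a b)) (+-≋-cong a⊖b≋0 (≋-refl {b}))

  ≋ᵇ-+ʳ : ∀ a b d → (a + d ≋ᵇ b + d) ≡ (a ≋ᵇ b)
  ≋ᵇ-+ʳ a b d = does-⇔ (mk⇔ (+-≋-cancelʳ d) (λ a≋b → +-≋-cong a≋b (≋-refl {d}))) (a + d ≋? b + d) (a ≋? b)

  ≋ᵇ-shift : ∀ x y {x' y'} e t → x + e ≡ x' → y + e ≋ y' → (x + t ≋ᵇ y) ≡ (x' + t ≋ᵇ y')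
  ≋ᵇ-shift x y {x'} {y'} e t x+e≡x' y+e≋y' = begin
    (x + t ≋ᵇ y)          ≡⟨ ≋ᵇ-+ʳ (x + t) y e ⟨
    (x + t + e ≋ᵇ y + e)  ≡⟨ ≋ᵇ-cong (≋-reflexive (trans (xy∙z≈xz∙y x t e) (cong (_+ t) x+e≡x'))) y+e≋y' ⟩
    (x' + t ≋ᵇ y')        ∎
    where open ≡-Reasoning

  ⊖-% : ∀ {d} .{{_ : NonZero d}} → d ∣ N → ∀ a b → (a ⊖ b) % d ≡ (a % d + (d ∸ b % d)) % d
  ⊖-% {d} d∣N a b = begin
    x                          ≡⟨ m%n%n≡m%n (a ⊖ b) d ⟨
    x % d                      ≡⟨ [m+n]%n≡m%n x d ⟨
    (x + d) % d                ≡⟨ cong (λ n → (x + n) % d) (m+[n∸m]≡n (<⇒≤ (m%n<n b d))) ⟨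
    (x + (β + (d ∸ β))) % d    ≡⟨ cong (_% d) (+-assoc x β (d ∸ β)) ⟨
    (x + β + (d ∸ β)) % d      ≡⟨ [m%d+n]%d≡[m+n]%d (x + β) (d ∸ β) d ⟨
    ((x + β) % d + (d ∸ β)) % d ≡⟨ cong (λ σ → (σ + (d ∸ β)) % d) x+β≡a ⟩
    (a % d + (d ∸ β)) % d      ∎
    where
    open ≡-Reasoning
    x = (a ⊖ b) % d
    β = b % d
    x+β≡a : (x + β) % d ≡ a % d
    x+β≡a = trans (sym (%-distribˡ-+ (a ⊖ b) b d)) (≋⇒%-≡ d∣N (⊖-+ a b))

  ModInvariant : (ℕ → Bool) → Set
  ModInvariant f = ∀ {a b} → a ≋ b → f a ≡ f b

  ∧-invariant : ∀ {f g} → ModInvariant f → ModInvariant g → ModInvariant (λ j → f j ∧ g j)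
  ∧-invariant f-inv g-inv a≋b = cong₂ _∧_ (f-inv a≋b) (g-inv a≋b)

  ⊖ˡ-invariant : ∀ {f} c → ModInvariant f → ModInvariant (λ j → f (c ⊖ j))
  ⊖ˡ-invariant c f-inv a≋b = f-inv (⊖-cong (≋-refl {c}) a≋b)

  +ʳ-invariant : ∀ {f} c → ModInvariant f → ModInvariant (λ j → f (j + c))
  +ʳ-invariant c f-inv a≋b = f-inv (+-≋-cong a≋b (≋-refl {c}))

  count-translate-mod : ∀ f c → ModInvariant f → count N (λ j → f (j + c)) ≡ count N f
  count-translate-mod f c inv = count-translate N f c (λ i → inv (≋-trans (≋-reflexive (+-comm N i)) (+N-≋ i)))

  count-⊖ʳ : ∀ f c → ModInvariant f → count N (λ j → f (j ⊖ c)) ≡ count N f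
  count-⊖ʳ f c = count-translate-mod f (N ∸ c % N)

  count-⊖ˡ : ∀ f c → ModInvariant f → count N (λ j → f (c ⊖ j)) ≡ count N f
  count-⊖ˡ f c inv = begin
    count N (λ j → f (c ⊖ j))        ≡⟨ count-cong N (λ j<N → cong (λ r → f (c + (N ∸ r))) (m<n⇒m%n≡m j<N)) ⟩
    count N (λ j → f (c + (N ∸ j)))  ≡⟨ count-congᵉ N (λ j → cong f (+-comm c (N ∸ j))) ⟩
    count N (λ j → f ((N ∸ j) + c))  ≡⟨ count-reflect N (λ m → f (m + c)) (inv (≋-trans (≋-reflexive (+-comm N c)) (+N-≋ c))) ⟩
    count N (λ j → f (j + c))        ≡⟨ count-translate-mod f c inv ⟩
    count N f                        ∎
    where open ≡-Reasoning

module ConnectionSet (h : ℕ) where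

  k : ℕ
  k = suc (h * 2)

  N : ℕ
  N = 4 * k

  open Modular N public

  0<4 : 0 < 4
  0<4 = s≤s z≤n

  1<4 : 1 < 4
  1<4 = s≤s (s≤s z≤n)

  2<4 : 2 < 4
  2<4 = s≤s (s≤s (s≤s z≤n))

  3<4 : 3 < 4
  3<4 = s≤s (s≤s (s≤s (s≤s z≤n)))

  N≡k*4 : N ≡ k * 4
  N≡k*4 = *-comm 4 k

  4∣N : 4 ∣ N
  4∣N = divides k N≡k*4

  ≋⇒%4 : ∀ {a b} → a ≋ b → a % 4 ≡ b % 4
  ≋⇒%4 = ≋⇒%-≡ 4∣N

  ρ+q*4<N : ∀ {ρ q} → ρ < 4 → q < k → ρ + q * 4 < N
  ρ+q*4<N {ρ} {q} ρ<4 q<k = subst (ρ + q * 4 <_) (sym N≡k*4) (begin-strict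
    ρ + q * 4   <⟨ +-monoˡ-< (q * 4) ρ<4 ⟩
    suc q * 4   ≤⟨ *-monoˡ-≤ 4 q<k ⟩
    k * 4       ∎)
    where open ≤-Reasoning

  ≋ᵇ-class : ∀ {ρ q q'} → ρ < 4 → q < k → q' < k → (ρ + q * 4 ≋ᵇ ρ + q' * 4) ≡ does (q ≟ q')
  ≋ᵇ-class {ρ} {q} {q'} ρ<4 q<k q'<k = does-⇔ (mk⇔ to from) (ρ + q * 4 ≋? ρ + q' * 4) (q ≟ q')
    where
    to : ρ + q * 4 ≋ ρ + q' * 4 → q ≡ q'
    to e = *-cancelʳ-≡ q q' 4 (+-cancelˡ-≡ ρ _ _ (≋⇒≡ (ρ+q*4<N ρ<4 q<k) (ρ+q*4<N ρ<4 q'<k) e))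
    from : q ≡ q' → ρ + q * 4 ≋ ρ + q' * 4
    from refl = ≋-refl

  h<k : h < k
  h<k = s≤s (subst (h ≤_) (*-comm 2 h) (m≤m+n h _))

  h*2<k : h * 2 < k
  h*2<k = ≤-refl

  -- c = 2(k-1), p₁ = 2k-1, p₂ = -2, p₃ = -1 (mod N)
  c p₁ p₂ p₃ : ℕ
  c  = h * 4
  p₁ = 1 + h * 4
  p₂ = 2 + h * 2 * 4
  p₃ = 3 + h * 2 * 4

  -- Z₀ r and Z₁ r decide x^r ∈ Z and y x^r ∈ Z; Z₁ is described class by class mod 4.
  Z₀ : ℕ → Bool
  Z₀ r = does (r % 4 ≟ 2)

  Z₁-on-class : ℕ → ℕ → Bool
  Z₁-on-class 0 r = not (r ≋ᵇ c)
  Z₁-on-class 1 r = r ≋ᵇ p₁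
  Z₁-on-class 2 r = r ≋ᵇ p₂
  Z₁-on-class _ r = r ≋ᵇ p₃

  Z₁ : ℕ → Bool
  Z₁ r = Z₁-on-class (r % 4) r

  inZ : Bool → ℕ → Bool
  inZ false = Z₀
  inZ true  = Z₁

  Z₀-invariant : ModInvariant Z₀
  Z₀-invariant a≋b = cong (λ σ → does (σ ≟ 2)) (≋⇒%4 a≋b)

  Z₁-invariant : ModInvariant Z₁
  Z₁-invariant {a} {b} a≋b = trans (cong (λ σ → Z₁-on-class σ a) (≋⇒%4 a≋b)) (on-class (b % 4))
    where
    on-class : ∀ σ → Z₁-on-class σ a ≡ Z₁-on-class σ b
    on-class 0                   = cong not (≋ᵇ-cong a≋b (≋-refl {c}))
    on-class 1                   = ≋ᵇ-cong a≋b (≋-refl {p₁})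
    on-class 2                   = ≋ᵇ-cong a≋b (≋-refl {p₂})
    on-class (suc (suc (suc _))) = ≋ᵇ-cong a≋b (≋-refl {p₃})

  inZ-invariant : ∀ b → ModInvariant (inZ b)
  inZ-invariant false = Z₀-invariant
  inZ-invariant true  = Z₁-invariant

  Z₁-at : ∀ {r σ} → r % 4 ≡ σ → Z₁ r ≡ Z₁-on-class σ r
  Z₁-at {r} = cong (λ σ → Z₁-on-class σ r)

  Z₀-class : ∀ {ρ} q → ρ < 4 → Z₀ (ρ + q * 4) ≡ does (ρ ≟ 2)
  Z₀-class q ρ<4 = cong (λ σ → does (σ ≟ 2)) ([m+kn]%n≡m q ρ<4)

  Z₁-class₀ : ∀ {q} → q < k → Z₁ (q * 4) ≡ not (does (q ≟ h))
  Z₁-class₀ {q} q<k = trans (Z₁-at {q * 4} ([m+kn]%n≡m q 0<4)) (cong not (≋ᵇ-class 0<4 q<k h<k))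

  Z₁-class₁ : ∀ {q} → q < k → Z₁ (1 + q * 4) ≡ does (q ≟ h)
  Z₁-class₁ {q} q<k = trans (Z₁-at {1 + q * 4} ([m+kn]%n≡m q 1<4)) (≋ᵇ-class 1<4 q<k h<k)

  Z₁-class₂ : ∀ {q} → q < k → Z₁ (2 + q * 4) ≡ does (q ≟ h * 2)
  Z₁-class₂ {q} q<k = trans (Z₁-at {2 + q * 4} ([m+kn]%n≡m q 2<4)) (≋ᵇ-class 2<4 q<k h*2<k)

  Z₁-class₃ : ∀ {q} → q < k → Z₁ (3 + q * 4) ≡ does (q ≟ h * 2)
  Z₁-class₃ {q} q<k = trans (Z₁-at {3 + q * 4} ([m+kn]%n≡m q 3<4)) (≋ᵇ-class 3<4 q<k h*2<k)

  count-N-by-residue : ∀ (f : ℕ → Bool) → count N f ≡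
    count k (λ q → f (q * 4)) + count k (λ q → f (1 + q * 4)) + count k (λ q → f (2 + q * 4)) + count k (λ q → f (3 + q * 4))
  count-N-by-residue f = trans (cong (λ n → count n f) N≡k*4) (count-by-residue-mod-4 k f)

  count-Z₀-∧ : ∀ (g : ℕ → Bool) → count N (λ r → Z₀ r ∧ g r) ≡ count k (λ q → g (2 + q * 4))
  count-Z₀-∧ g = begin
    count N (λ r → Z₀ r ∧ g r)
      ≡⟨ count-N-by-residue (λ r → Z₀ r ∧ g r) ⟩
    count k (λ q → Z₀ (q * 4) ∧ g (q * 4)) + count k (λ q → Z₀ (1 + q * 4) ∧ g (1 + q * 4))
      + count k (λ q → Z₀ (2 + q * 4) ∧ g (2 + q * 4)) + count k (λ q → Z₀ (3 + q * 4) ∧ g (3 + q * 4))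
      ≡⟨ cong₂ _+_ (cong₂ _+_ (cong₂ _+_ (off 0<4 refl) (off 1<4 refl)) on) (off 3<4 refl) ⟩
    0 + 0 + count k (λ q → g (2 + q * 4)) + 0
      ≡⟨ +-identityʳ _ ⟩
    count k (λ q → g (2 + q * 4))
      ∎
    where
    open ≡-Reasoning
    off : ∀ {ρ} → ρ < 4 → does (ρ ≟ 2) ≡ false → count k (λ q → Z₀ (ρ + q * 4) ∧ g (ρ + q * 4)) ≡ 0
    off {ρ} ρ<4 ρ≢2 = trans (count-congᵉ k (λ q → cong (_∧ g (ρ + q * 4)) (trans (Z₀-class q ρ<4) ρ≢2))) (count-false k)
    on : count k (λ q → Z₀ (2 + q * 4) ∧ g (2 + q * 4)) ≡ count k (λ q → g (2 + q * 4))
    on = count-congᵉ k (λ q → cong (_∧ g (2 + q * 4)) (Z₀-class q 2<4))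

  count-Z₁-∧ : ∀ (g : ℕ → Bool) → count N (λ r → Z₁ r ∧ g r) ≡
    count k (λ q → not (does (q ≟ h)) ∧ g (q * 4)) + 𝟙 (g p₁) + 𝟙 (g p₂) + 𝟙 (g p₃)
  count-Z₁-∧ g = trans (count-N-by-residue (λ r → Z₁ r ∧ g r)) (cong₂ _+_ (cong₂ _+_ (cong₂ _+_
      (count-cong k (λ {q} q<k → cong (_∧ g (q * 4)) (Z₁-class₀ q<k)))
      (point 1 h Z₁-class₁ h<k))
      (point 2 (h * 2) Z₁-class₂ h*2<k))
      (point 3 (h * 2) Z₁-class₃ h*2<k))
    where
    point : ∀ ρ a → (∀ {q} → q < k → Z₁ (ρ + q * 4) ≡ does (q ≟ a)) → a < k →
            count k (λ q → Z₁ (ρ + q * 4) ∧ g (ρ + q * 4)) ≡ 𝟙 (g (ρ + a * 4))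
    point ρ a on-class a<k = trans (count-cong k (λ {q} q<k → cong (_∧ g (ρ + q * 4)) (on-class q<k)))
                                   (count-at k a (λ q → g (ρ + q * 4)) a<k)

  count-Z₀ : count N Z₀ ≡ k
  count-Z₀ = begin
    count N Z₀                    ≡⟨ count-congᵉ N (λ r → sym (∧-identityʳ (Z₀ r))) ⟩
    count N (λ r → Z₀ r ∧ true)   ≡⟨ count-Z₀-∧ (const true) ⟩
    count k (const true)          ≡⟨ count-true k ⟩
    k                             ∎
    where open ≡-Reasoning

  count-Z₁ : count N Z₁ ≡ k + 2
  count-Z₁ = begin
    count N Z₁                                       ≡⟨ count-congᵉ N (λ r → sym (∧-identityʳ (Z₁ r))) ⟩
    count N (λ r → Z₁ r ∧ true)                      ≡⟨ count-Z₁-∧ (const true) ⟩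
    count k (λ q → not (does (q ≟ h)) ∧ true) + 1 + 1 + 1
      ≡⟨ cong (λ m → m + 1 + 1 + 1) (count-congᵉ k (λ q → ∧-identityʳ (not (does (q ≟ h))))) ⟩
    count k (λ q → not (does (q ≟ h))) + 1 + 1 + 1   ≡⟨ cong (λ m → m + 1 + 1) (count-≢ k h<k) ⟩
    k + 1 + 1                                        ≡⟨ +-assoc k 1 1 ⟩
    k + 2                                            ∎
    where open ≡-Reasoning

  count-Z₁-class₀ : count k (λ q → Z₁ (q * 4)) + 1 ≡ k
  count-Z₁-class₀ = trans (cong (_+ 1) (count-cong k Z₁-class₀)) (count-≢ k h<k)

  count-Z₁-class : ∀ {σ} → σ < 4 → σ ≢ 0 → count k (λ q → Z₁ (σ + q * 4)) ≡ 1
  count-Z₁-class {0} _ σ≢0 = ⊥-elim (σ≢0 refl)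
  count-Z₁-class {1} _ _   = trans (count-cong k Z₁-class₁) (count-≡ k h<k)
  count-Z₁-class {2} _ _   = trans (count-cong k Z₁-class₂) (count-≡ k h*2<k)
  count-Z₁-class {3} _ _   = trans (count-cong k Z₁-class₃) (count-≡ k h*2<k)
  count-Z₁-class {suc (suc (suc (suc _)))} (s≤s (s≤s (s≤s (s≤s ())))) _

  count-class-translate : ∀ f t → ModInvariant f →
    count k (λ q → f (q * 4 + t)) ≡ count k (λ q → f (t % 4 + q * 4))
  count-class-translate f t f-inv = begin
    count k (λ q → f (q * 4 + t))  ≡⟨ count-congᵉ k (λ q → cong f (trans (cong (q * 4 +_) (m≡m%n+[m/n]*n t 4))
                                                                          (regroup q (t % 4) (t / 4)))) ⟩
    count k (λ q → f′ (q + t / 4)) ≡⟨ count-translate k f′ (t / 4) periodic ⟩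
    count k f′                     ∎
    where
    open ≡-Reasoning
    f′ : ℕ → Bool
    f′ q = f (t % 4 + q * 4)
    regroup : ∀ q σ τ → q * 4 + (σ + τ * 4) ≡ σ + (q + τ) * 4
    regroup = solve-∀
    add-period : ∀ q σ m → σ + (m + q) * 4 ≡ σ + q * 4 + m * 4
    add-period = solve-∀
    periodic : ∀ q → f′ (k + q) ≡ f′ q
    periodic q = f-inv (≋-trans (≋-reflexive (trans (add-period q (t % 4) k) (cong (t % 4 + q * 4 +_) (sym N≡k*4))))
                                (+N-≋ (t % 4 + q * 4)))

  autocorrelation₀ : ∀ t → count N (λ j → Z₀ j ∧ Z₀ (j + t)) ≡ count k (const (Z₀ (2 + t % 4)))
  autocorrelation₀ t = trans (count-Z₀-∧ (λ r → Z₀ (r + t)))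
    (count-congᵉ k (λ q → cong (λ σ → does (σ ≟ 2)) ([m+kn+o]%n≡[m+o%n]%n 2 q t 4)))

  autocorrelation₁ : ∀ t → count N (λ j → Z₁ j ∧ Z₁ (j + t)) + 𝟙 (Z₁ (c + t)) ≡
    count k (λ q → Z₁ (t % 4 + q * 4)) + (𝟙 (Z₁ (p₁ + t)) + 𝟙 (Z₁ (p₂ + t)) + 𝟙 (Z₁ (p₃ + t)))
  autocorrelation₁ t = begin
    count N (λ j → Z₁ j ∧ Z₁ (j + t)) + eᶜ  ≡⟨ cong (_+ eᶜ) (count-Z₁-∧ (λ r → Z₁ (r + t))) ⟩
    X + e₁ + e₂ + e₃ + eᶜ                   ≡⟨ regroup X e₁ e₂ e₃ eᶜ ⟩
    (eᶜ + X) + (e₁ + e₂ + e₃)               ≡⟨ cong (_+ (e₁ + e₂ + e₃)) eᶜ+X ⟩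
    count k (λ q → Z₁ (t % 4 + q * 4)) + (e₁ + e₂ + e₃) ∎
    where
    open ≡-Reasoning
    X  = count k (λ q → not (does (q ≟ h)) ∧ Z₁ (q * 4 + t))
    eᶜ = 𝟙 (Z₁ (c + t))
    e₁ = 𝟙 (Z₁ (p₁ + t))
    e₂ = 𝟙 (Z₁ (p₂ + t))
    e₃ = 𝟙 (Z₁ (p₃ + t))
    regroup : ∀ X a b c e → X + a + b + c + e ≡ (e + X) + (a + b + c)
    regroup = solve-∀
    eᶜ+X : eᶜ + X ≡ count k (λ q → Z₁ (t % 4 + q * 4))
    eᶜ+X = begin
      eᶜ + X                                                       ≡⟨ cong (_+ X) (count-at k h (λ q → Z₁ (q * 4 + t)) h<k) ⟨
      count k (λ q → does (q ≟ h) ∧ Z₁ (q * 4 + t)) + X            ≡⟨ count-partition k (λ q → does (q ≟ h)) (λ q → Z₁ (q * 4 + t)) ⟩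
      count k (λ q → Z₁ (q * 4 + t))                               ≡⟨ count-class-translate Z₁ t Z₁-invariant ⟩
      count k (λ q → Z₁ (t % 4 + q * 4))                           ∎

  -- d = 2k has order 2 mod N, and the points of Z₁ outside class 0 are c + 1, c + d, c + d + 1.
  d : ℕ
  d = 2 + h * 4

  c+1≡p₁ : c + 1 ≡ p₁
  c+1≡p₁ = +-comm c 1

  p₂+1≡p₃ : p₂ + 1 ≡ p₃
  p₂+1≡p₃ = +-comm p₂ 1

  c+d≡p₂ : c + d ≡ p₂
  c+d≡p₂ = lemma h
    where
    lemma : ∀ h → h * 4 + (2 + h * 4) ≡ 2 + h * 2 * 4
    lemma = solve-∀

  p₁+d≡p₃ : p₁ + d ≡ p₃
  p₁+d≡p₃ = lemma h
    where
    lemma : ∀ h → 1 + h * 4 + (2 + h * 4) ≡ 3 + h * 2 * 4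
    lemma = solve-∀

  p₂+d≋c : p₂ + d ≋ c
  p₂+d≋c = ≋-trans (≋-reflexive (lemma h)) (+N-≋ c)
    where
    lemma : ∀ h → 2 + h * 2 * 4 + (2 + h * 4) ≡ h * 4 + 4 * suc (h * 2)
    lemma = solve-∀

  p₃+d≋p₁ : p₃ + d ≋ p₁
  p₃+d≋p₁ = ≋-trans (≋-reflexive (lemma h)) (+N-≋ p₁)
    where
    lemma : ∀ h → 3 + h * 2 * 4 + (2 + h * 4) ≡ 1 + h * 4 + 4 * suc (h * 2)
    lemma = solve-∀

  Z₁-shifted : ∀ t {σ} → t % 4 ≡ σ → ∀ a q → Z₁ (a + q * 4 + t) ≡ Z₁-on-class ((a + σ) % 4) (a + q * 4 + t)
  Z₁-shifted t t%4≡σ a q = Z₁-at (trans ([m+kn+o]%n≡[m+o%n]%n a q t 4) (cong (λ σ → (a + σ) % 4) t%4≡σ))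

  Z₁-shifted-points₀ : ∀ t → t % 4 ≡ 0 → ¬ t ≋ 0 →
    Z₁ (c + t) ≡ true × 𝟙 (Z₁ (p₁ + t)) + 𝟙 (Z₁ (p₂ + t)) + 𝟙 (Z₁ (p₃ + t)) ≡ 0
  Z₁-shifted-points₀ t t%4≡0 t≉0 =
      trans (on 0 h) (cong not (moved c))
    , cong₂ _+_ (cong₂ _+_ (cong 𝟙 (trans (on 1 h) (moved p₁))) (cong 𝟙 (trans (on 2 (h * 2)) (moved p₂))))
                (cong 𝟙 (trans (on 3 (h * 2)) (moved p₃)))
    where
    on = Z₁-shifted t t%4≡0
    moved : ∀ x → (x + t ≋ᵇ x) ≡ false
    moved x = trans (≋ᵇ-cong (≋-reflexive (+-comm x t)) (≋-refl {x}))
                    (trans (≋ᵇ-+ʳ t 0 x) (dec-false (t ≋? 0) t≉0))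

  -- In each class, one of the three indicators equals Z₁ (c + t) and the other two are complementary.
  Z₁-shifted-points : ∀ t → t % 4 ≢ 0 →
    𝟙 (Z₁ (p₁ + t)) + 𝟙 (Z₁ (p₂ + t)) + 𝟙 (Z₁ (p₃ + t)) ≡ 1 + 𝟙 (Z₁ (c + t))
  Z₁-shifted-points t σ≢0 = by-class (t % 4) refl σ≢0 (m%n<n t 4)
    where
    open ≡-Reasoning
    by-class : ∀ σ → t % 4 ≡ σ → σ ≢ 0 → σ < 4 →
      𝟙 (Z₁ (p₁ + t)) + 𝟙 (Z₁ (p₂ + t)) + 𝟙 (Z₁ (p₃ + t)) ≡ 1 + 𝟙 (Z₁ (c + t))
    by-class 0 _ σ≢0 _ = ⊥-elim (σ≢0 refl)
    by-class 1 t%4≡1 _ _ = begin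
      𝟙 (Z₁ (p₁ + t)) + 𝟙 (Z₁ (p₂ + t)) + 𝟙 (Z₁ (p₃ + t))
        ≡⟨ cong₂ _+_ (cong₂ _+_ (cong 𝟙 (on 1 h))
                                (cong 𝟙 (trans (on 2 (h * 2)) (sym (≋ᵇ-shift c p₁ d t c+d≡p₂ (≋-reflexive p₁+d≡p₃))))))
                     (cong 𝟙 (trans (on 3 (h * 2)) (cong not (sym (≋ᵇ-shift p₁ p₂ d t p₁+d≡p₃ p₂+d≋c))))) ⟩
      𝟙 F + 𝟙 E + 𝟙 (not F)  ≡⟨ xy∙z≈xz∙y (𝟙 F) (𝟙 E) (𝟙 (not F)) ⟩
      𝟙 F + 𝟙 (not F) + 𝟙 E  ≡⟨ cong (_+ 𝟙 E) (𝟙-not F) ⟩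
      1 + 𝟙 E                ≡⟨ cong (λ b → 1 + 𝟙 b) (on 0 h) ⟨
      1 + 𝟙 (Z₁ (c + t))     ∎
      where
      on = Z₁-shifted t t%4≡1
      E = c + t ≋ᵇ p₁
      F = p₁ + t ≋ᵇ p₂
    by-class 2 t%4≡2 _ _ = begin
      𝟙 (Z₁ (p₁ + t)) + 𝟙 (Z₁ (p₂ + t)) + 𝟙 (Z₁ (p₃ + t))
        ≡⟨ cong₂ _+_ (cong₂ _+_ (cong 𝟙 (trans (on 1 h) (sym (≋ᵇ-shift c p₂ 1 t c+1≡p₁ (≋-reflexive p₂+1≡p₃)))))
                                (cong 𝟙 (trans (on 2 (h * 2)) (cong not (sym E≡p₂+t≋c)))))
                     (cong 𝟙 (trans (on 3 (h * 2)) (sym (trans E≡p₂+t≋c (≋ᵇ-shift p₂ c 1 t p₂+1≡p₃ (≋-reflexive c+1≡p₁)))))) ⟩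
      𝟙 E + 𝟙 (not E) + 𝟙 E  ≡⟨ cong (_+ 𝟙 E) (𝟙-not E) ⟩
      1 + 𝟙 E                ≡⟨ cong (λ b → 1 + 𝟙 b) (on 0 h) ⟨
      1 + 𝟙 (Z₁ (c + t))     ∎
      where
      on = Z₁-shifted t t%4≡2
      E = c + t ≋ᵇ p₂
      E≡p₂+t≋c : E ≡ (p₂ + t ≋ᵇ c)
      E≡p₂+t≋c = ≋ᵇ-shift c p₂ d t c+d≡p₂ p₂+d≋c
    by-class 3 t%4≡3 _ _ = begin
      𝟙 (Z₁ (p₁ + t)) + 𝟙 (Z₁ (p₂ + t)) + 𝟙 (Z₁ (p₃ + t))
        ≡⟨ cong₂ _+_ (cong₂ _+_ (cong 𝟙 (on 1 h))
                                (cong 𝟙 (trans (on 2 (h * 2)) (sym (≋ᵇ-shift c p₃ d t c+d≡p₂ p₃+d≋p₁)))))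
                     (cong 𝟙 (trans (on 3 (h * 2)) (sym (≋ᵇ-shift p₁ c d t p₁+d≡p₃ (≋-reflexive c+d≡p₂))))) ⟩
      𝟙 (not F) + 𝟙 E + 𝟙 F  ≡⟨ xy∙z≈xz∙y (𝟙 (not F)) (𝟙 E) (𝟙 F) ⟩
      𝟙 (not F) + 𝟙 F + 𝟙 E  ≡⟨ cong (_+ 𝟙 E) (trans (+-comm (𝟙 (not F)) (𝟙 F)) (𝟙-not F)) ⟩
      1 + 𝟙 E                ≡⟨ cong (λ b → 1 + 𝟙 b) (on 0 h) ⟨
      1 + 𝟙 (Z₁ (c + t))     ∎
      where
      on = Z₁-shifted t t%4≡3
      E = c + t ≋ᵇ p₃
      F = p₁ + t ≋ᵇ c
    by-class (suc (suc (suc (suc _)))) _ _ (s≤s (s≤s (s≤s (s≤s ()))))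

  sameType : ℕ → ℕ
  sameType t = count N (λ j → Z₀ j ∧ Z₀ (j + t)) + count N (λ j → Z₁ j ∧ Z₁ (j + t))

  sameType-special : ∀ t → t % 4 ≡ 0 → ¬ t ≋ 0 → sameType t ≡ 2 * (k ∸ 1)
  sameType-special t t%4≡0 t≉0 = begin
    sameType t    ≡⟨ cong (_+ X) (trans (autocorrelation₀ t) (trans (cong (λ σ → count k (const (Z₀ (2 + σ)))) t%4≡0) (count-true k))) ⟩
    k + X         ≡⟨ cong (_+ X) k≡X+2 ⟩
    X + 1 + 1 + X ≡⟨ double X ⟩
    2 * (X + 1)   ≡⟨ cong (2 *_) (m+n∸n≡m (X + 1) 1) ⟨
    2 * (X + 1 + 1 ∸ 1) ≡⟨ cong (λ m → 2 * (m ∸ 1)) k≡X+2 ⟨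
    2 * (k ∸ 1)   ∎
    where
    open ≡-Reasoning
    X = count N (λ j → Z₁ j ∧ Z₁ (j + t))
    points = Z₁-shifted-points₀ t t%4≡0 t≉0
    double : ∀ X → X + 1 + 1 + X ≡ 2 * (X + 1)
    double = solve-∀
    k≡X+2 : k ≡ X + 1 + 1
    k≡X+2 = sym (begin
      X + 1 + 1                                     ≡⟨ cong (λ b → X + 𝟙 b + 1) (proj₁ points) ⟨
      X + 𝟙 (Z₁ (c + t)) + 1                        ≡⟨ cong (_+ 1) (autocorrelation₁ t) ⟩
      count k (λ q → Z₁ (t % 4 + q * 4)) + _ + 1    ≡⟨ cong₂ (λ σ m → count k (λ q → Z₁ (σ + q * 4)) + m + 1) t%4≡0 (proj₂ points) ⟩
      count k (λ q → Z₁ (q * 4)) + 0 + 1            ≡⟨ cong (_+ 1) (+-identityʳ _) ⟩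
      count k (λ q → Z₁ (q * 4)) + 1                ≡⟨ count-Z₁-class₀ ⟩
      k                                             ∎)

  sameType-generic : ∀ t → t % 4 ≢ 0 → sameType t ≡ 2
  sameType-generic t σ≢0 = cong₂ _+_ (trans (autocorrelation₀ t) (trans (count-congᵉ k (λ _ → Z₀-off (t % 4) (m%n<n t 4) σ≢0)) (count-false k)))
    (+-cancelʳ-≡ (𝟙 (Z₁ (c + t))) _ 2 (trans (autocorrelation₁ t)
      (cong₂ _+_ (count-Z₁-class (m%n<n t 4) σ≢0) (Z₁-shifted-points t σ≢0))))
    where
    Z₀-off : ∀ σ → σ < 4 → σ ≢ 0 → Z₀ (2 + σ) ≡ false
    Z₀-off 0 _ σ≢0 = ⊥-elim (σ≢0 refl)
    Z₀-off 1 _ _ = refl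
    Z₀-off 2 _ _ = refl
    Z₀-off 3 _ _ = refl
    Z₀-off (suc (suc (suc (suc _)))) (s≤s (s≤s (s≤s (s≤s ())))) _

  ⊖-%4 : ∀ a b → (a ⊖ b) % 4 ≡ (a % 4 + (4 ∸ b % 4)) % 4
  ⊖-%4 = ⊖-% 4∣N

  Z₀-⊖ : ∀ t m {ρ} → m % 4 ≡ ρ → Z₀ (t ⊖ m) ≡ Z₀ (t % 4 + (4 ∸ ρ))
  Z₀-⊖ t m m%4≡ρ = cong (λ σ → does (σ ≟ 2)) (trans (⊖-%4 t m) (cong (λ r → (t % 4 + (4 ∸ r)) % 4) m%4≡ρ))

  convolution-profile : ℕ → ℕ
  convolution-profile σ = count k (λ q → not (does (q ≟ h)) ∧ Z₀ (σ + 4)) + 𝟙 (Z₀ (σ + 3)) + 𝟙 (Z₀ (σ + 2)) + 𝟙 (Z₀ (σ + 1))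

  convolution₁ : ∀ t → count N (λ j → Z₁ j ∧ Z₀ (t ⊖ j)) ≡ convolution-profile (t % 4)
  convolution₁ t = trans (count-Z₁-∧ (λ r → Z₀ (t ⊖ r))) (cong₂ _+_ (cong₂ _+_ (cong₂ _+_
    (count-congᵉ k (λ q → cong (not (does (q ≟ h)) ∧_) (Z₀-⊖ t (q * 4) ([m+kn]%n≡m q 0<4))))
    (cong 𝟙 (Z₀-⊖ t p₁ ([m+kn]%n≡m h 1<4))))
    (cong 𝟙 (Z₀-⊖ t p₂ ([m+kn]%n≡m (h * 2) 2<4))))
    (cong 𝟙 (Z₀-⊖ t p₃ ([m+kn]%n≡m (h * 2) 3<4))))

  convolution-sym : ∀ t → count N (λ j → Z₀ j ∧ Z₁ (t ⊖ j)) ≡ count N (λ j → Z₁ j ∧ Z₀ (t ⊖ j))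
  convolution-sym t = begin
    count N f                 ≡⟨ count-⊖ˡ f t (∧-invariant Z₀-invariant (⊖ˡ-invariant t Z₁-invariant)) ⟨
    count N (λ j → f (t ⊖ j)) ≡⟨ count-congᵉ N (λ j → trans (cong (Z₀ (t ⊖ j) ∧_) (Z₁-invariant (⊖-involutive t j)))
                                                             (∧-comm (Z₀ (t ⊖ j)) (Z₁ j))) ⟩
    count N (λ j → Z₁ j ∧ Z₀ (t ⊖ j)) ∎
    where
    open ≡-Reasoning
    f : ℕ → Bool
    f j = Z₀ j ∧ Z₁ (t ⊖ j)

  mixedType : ℕ → ℕ
  mixedType t = count N (λ j → Z₀ j ∧ Z₁ (t ⊖ j)) + count N (λ j → Z₁ j ∧ Z₀ (t ⊖ j))

  mixedType-≡-double : ∀ t → mixedType t ≡ 2 * convolution-profile (t % 4)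
  mixedType-≡-double t = trans (cong₂ _+_ (trans (convolution-sym t) conv) conv) (cong (P +_) (sym (+-identityʳ P)))
    where
    conv = convolution₁ t
    P = convolution-profile (t % 4)

  mixedType-special : ∀ t → t % 4 ≡ 2 → mixedType t ≡ 2 * (k ∸ 1)
  mixedType-special t t%4≡2 = trans (mixedType-≡-double t) (cong (2 *_) (trans (cong convolution-profile t%4≡2) profile₂))
    where
    profile₂ : convolution-profile 2 ≡ k ∸ 1
    profile₂ = begin
      count k (λ q → not (does (q ≟ h)) ∧ true) + 0 + 0 + 0  ≡⟨ +-identityʳ _ ⟩
      count k (λ q → not (does (q ≟ h)) ∧ true) + 0 + 0      ≡⟨ +-identityʳ _ ⟩
      count k (λ q → not (does (q ≟ h)) ∧ true) + 0          ≡⟨ +-identityʳ _ ⟩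
      count k (λ q → not (does (q ≟ h)) ∧ true)              ≡⟨ count-congᵉ k (λ q → ∧-identityʳ (not (does (q ≟ h)))) ⟩
      count k (λ q → not (does (q ≟ h)))                     ≡⟨ m+n∸n≡m _ 1 ⟨
      count k (λ q → not (does (q ≟ h))) + 1 ∸ 1             ≡⟨ cong (_∸ 1) (count-≢ k h<k) ⟩
      k ∸ 1                                                  ∎
      where open ≡-Reasoning

  mixedType-generic : ∀ t → t % 4 ≢ 2 → mixedType t ≡ 2
  mixedType-generic t σ≢2 = trans (mixedType-≡-double t) (cong (2 *_) (profile (t % 4) (m%n<n t 4) σ≢2))
    where
    none : count k (λ q → not (does (q ≟ h)) ∧ false) ≡ 0
    none = trans (count-congᵉ k (λ q → ∧-zeroʳ (not (does (q ≟ h))))) (count-false k)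
    profile : ∀ σ → σ < 4 → σ ≢ 2 → convolution-profile σ ≡ 1
    profile 0 _ _ = cong (λ m → m + 0 + 1 + 0) none
    profile 1 _ _ = cong (λ m → m + 0 + 0 + 1) none
    profile 2 _ σ≢2 = ⊥-elim (σ≢2 refl)
    profile 3 _ _ = cong (λ m → m + 1 + 0 + 0) none
    profile (suc (suc (suc (suc _)))) (s≤s (s≤s (s≤s (s≤s ())))) _

  Z₀-neg : ∀ x → Z₀ (0 ⊖ x) ≡ Z₀ x
  Z₀-neg x = trans (Z₀-⊖ 0 x refl) (trans (by-class (x % 4) (m%n<n x 4)) (cong (λ σ → does (σ ≟ 2)) (m%n%n≡m%n x 4)))
    where
    by-class : ∀ ρ → ρ < 4 → Z₀ (4 ∸ ρ) ≡ Z₀ ρ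
    by-class 0 _ = refl
    by-class 1 _ = refl
    by-class 2 _ = refl
    by-class 3 _ = refl
    by-class (suc (suc (suc (suc _)))) (s≤s (s≤s (s≤s (s≤s ()))))

  Z₀-⊖-comm : ∀ i j → Z₀ (i ⊖ j) ≡ Z₀ (j ⊖ i)
  Z₀-⊖-comm i j = trans (Z₀-invariant (≋-sym neg)) (Z₀-neg (j ⊖ i))
    where
    neg : 0 ⊖ (j ⊖ i) ≋ i ⊖ j
    neg = ≋-trans (⊖-cong (≋-sym (+-⊖-cancelʳ 0 i)) (≋-refl {j ⊖ i})) (⊖-⊖-cancelʳ i j i)

  -- nbr a i b j decides (b , j) · (a , i)⁻¹ ∈ Z, i.e. adjacency of (a , i) and (b , j).
  nbr : Bool → ℕ → Bool → ℕ → Bool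
  nbr false i b j = inZ b (j ⊖ i)
  nbr true  i b j = inZ (not b) (i ⊖ j)

  nbr-sym : ∀ a i b j → nbr a i b j ≡ nbr b j a i
  nbr-sym false i false j = Z₀-⊖-comm j i
  nbr-sym false i true  j = refl
  nbr-sym true  i false j = refl
  nbr-sym true  i true  j = Z₀-⊖-comm i j

  degreeCount : Bool → ℕ → ℕ
  degreeCount a i = count N (nbr a i false) + count N (nbr a i true)

  commonCount : Bool → ℕ → Bool → ℕ → ℕ
  commonCount a i a' i' = count N (λ j → nbr a i false j ∧ nbr a' i' false j)
                        + count N (λ j → nbr a i true j ∧ nbr a' i' true j)

  degreeCount-value : ∀ a i → degreeCount a i ≡ 2 * (k + 1)
  degreeCount-value false i = begin
    count N (λ j → Z₀ (j ⊖ i)) + count N (λ j → Z₁ (j ⊖ i))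
      ≡⟨ cong₂ _+_ (count-⊖ʳ Z₀ i Z₀-invariant) (count-⊖ʳ Z₁ i Z₁-invariant) ⟩
    count N Z₀ + count N Z₁  ≡⟨ cong₂ _+_ count-Z₀ count-Z₁ ⟩
    k + (k + 2)              ≡⟨ lemma k ⟩
    2 * (k + 1)              ∎
    where
    open ≡-Reasoning
    lemma : ∀ k → k + (k + 2) ≡ 2 * (k + 1)
    lemma = solve-∀
  degreeCount-value true i = begin
    count N (λ j → Z₁ (i ⊖ j)) + count N (λ j → Z₀ (i ⊖ j))
      ≡⟨ cong₂ _+_ (count-⊖ˡ Z₁ i Z₁-invariant) (count-⊖ˡ Z₀ i Z₀-invariant) ⟩
    count N Z₁ + count N Z₀  ≡⟨ cong₂ _+_ count-Z₁ count-Z₀ ⟩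
    k + 2 + k                ≡⟨ lemma k ⟩
    2 * (k + 1)              ∎
    where
    open ≡-Reasoning
    lemma : ∀ k → k + 2 + k ≡ 2 * (k + 1)
    lemma = solve-∀

  commonCount-sym : ∀ a i a' i' → commonCount a i a' i' ≡ commonCount a' i' a i
  commonCount-sym a i a' i' = cong₂ _+_ (count-congᵉ N (λ j → ∧-comm (nbr a i false j) (nbr a' i' false j)))
                                        (count-congᵉ N (λ j → ∧-comm (nbr a i true j) (nbr a' i' true j)))

  commonCount-rotations : ∀ i i' → commonCount false i false i' ≡ sameType (i ⊖ i')
  commonCount-rotations i i' = cong₂ _+_ (term false) (term true)
    where
    open ≡-Reasoning
    term : ∀ b → count N (λ j → inZ b (j ⊖ i) ∧ inZ b (j ⊖ i')) ≡ count N (λ j → inZ b j ∧ inZ b (j + (i ⊖ i')))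
    term b = begin
      count N (λ j → inZ b (j ⊖ i) ∧ inZ b (j ⊖ i'))
        ≡⟨ count-congᵉ N (λ j → cong (inZ b (j ⊖ i) ∧_) (inZ-invariant b (≋-sym (⊖-telescope j i i')))) ⟩
      count N (λ j → inZ b (j ⊖ i) ∧ inZ b ((j ⊖ i) + (i ⊖ i')))
        ≡⟨ count-⊖ʳ _ i (∧-invariant (inZ-invariant b) (+ʳ-invariant (i ⊖ i') (inZ-invariant b))) ⟩
      count N (λ j → inZ b j ∧ inZ b (j + (i ⊖ i')))
        ∎

  commonCount-reflections : ∀ i i' → commonCount true i true i' ≡ sameType (i' ⊖ i)
  commonCount-reflections i i' = trans (cong₂ _+_ (term true) (term false)) (+-comm (count N (λ j → Z₁ j ∧ Z₁ (j + (i' ⊖ i)))) _)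
    where
    open ≡-Reasoning
    term : ∀ b → count N (λ j → inZ b (i ⊖ j) ∧ inZ b (i' ⊖ j)) ≡ count N (λ j → inZ b j ∧ inZ b (j + (i' ⊖ i)))
    term b = begin
      count N (λ j → inZ b (i ⊖ j) ∧ inZ b (i' ⊖ j))
        ≡⟨ count-congᵉ N (λ j → cong (inZ b (i ⊖ j) ∧_) (inZ-invariant b
             (≋-sym (≋-trans (≋-reflexive (+-comm (i ⊖ j) (i' ⊖ i))) (⊖-telescope i' i j))))) ⟩
      count N (λ j → inZ b (i ⊖ j) ∧ inZ b ((i ⊖ j) + (i' ⊖ i)))
        ≡⟨ count-⊖ˡ _ i (∧-invariant (inZ-invariant b) (+ʳ-invariant (i' ⊖ i) (inZ-invariant b))) ⟩
      count N (λ j → inZ b j ∧ inZ b (j + (i' ⊖ i)))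
        ∎

  commonCount-mixed : ∀ i i' → commonCount false i true i' ≡ mixedType (i' ⊖ i)
  commonCount-mixed i i' = cong₂ _+_ (term false) (term true)
    where
    open ≡-Reasoning
    term : ∀ b → count N (λ j → inZ b (j ⊖ i) ∧ inZ (not b) (i' ⊖ j)) ≡ count N (λ j → inZ b j ∧ inZ (not b) ((i' ⊖ i) ⊖ j))
    term b = begin
      count N (λ j → inZ b (j ⊖ i) ∧ inZ (not b) (i' ⊖ j))
        ≡⟨ count-congᵉ N (λ j → cong (inZ b (j ⊖ i) ∧_) (inZ-invariant (not b) (≋-sym (⊖-⊖-cancelʳ i' j i)))) ⟩
      count N (λ j → inZ b (j ⊖ i) ∧ inZ (not b) ((i' ⊖ i) ⊖ (j ⊖ i)))
        ≡⟨ count-⊖ʳ _ i (∧-invariant (inZ-invariant b) (⊖ˡ-invariant (i' ⊖ i) (inZ-invariant (not b)))) ⟩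
      count N (λ j → inZ b j ∧ inZ (not b) ((i' ⊖ i) ⊖ j))
        ∎

  2[k∸1]≡0⇒h≡0 : 2 * (k ∸ 1) ≡ 0 → h ≡ 0
  2[k∸1]≡0⇒h≡0 = lemma h
    where
    lemma : ∀ m → 2 * (m * 2) ≡ 0 → m ≡ 0
    lemma zero    _ = refl
    lemma (suc m) ()

  2[k∸1]≢2 : 2 * (k ∸ 1) ≢ 2
  2[k∸1]≢2 eq = 0≢1+n (trans (sym (m*n%n≡0 h 4)) (cong (_% 4) (trans (double h) eq)))
    where
    double : ∀ h → h * 4 ≡ 2 * (h * 2)
    double = solve-∀

  %N≡%4 : h ≡ 0 → ∀ t → t % N ≡ t % 4
  %N≡%4 h≡0 t = %-congʳ {o = t} (cong (λ m → 4 * suc (m * 2)) h≡0)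

  DezaValue : ℕ → Set
  DezaValue n = n ≡ 2 * (k ∸ 1) ⊎ n ≡ 2

  sameType-values : ∀ t → ¬ t ≋ 0 → DezaValue (sameType t)
  sameType-values t t≉0 = by-class (t % 4 ≟ 0)
    where
    by-class : Dec (t % 4 ≡ 0) → DezaValue (sameType t)
    by-class (yes t%4≡0) = inj₁ (sameType-special t t%4≡0 t≉0)
    by-class (no  t%4≢0) = inj₂ (sameType-generic t t%4≢0)

  sameType-nonzero : ∀ t → ¬ t ≋ 0 → sameType t ≢ 0
  sameType-nonzero t t≉0 isZero = by-class (t % 4 ≟ 0)
    where
    by-class : Dec (t % 4 ≡ 0) → ⊥
    by-class (yes t%4≡0) = t≉0 (mod-≡ (trans (%N≡%4 h≡0 t) t%4≡0))
      where
      h≡0 = 2[k∸1]≡0⇒h≡0 (trans (sym (sameType-special t t%4≡0 t≉0)) isZero)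
    by-class (no  t%4≢0) = 1+n≢0 (trans (sym (sameType-generic t t%4≢0)) isZero)

  mixedType-values : ∀ t → DezaValue (mixedType t)
  mixedType-values t = by-class (t % 4 ≟ 2)
    where
    by-class : Dec (t % 4 ≡ 2) → DezaValue (mixedType t)
    by-class (yes t%4≡2) = inj₁ (mixedType-special t t%4≡2)
    by-class (no  t%4≢2) = inj₂ (mixedType-generic t t%4≢2)

  -- Only for k = 1 can two vertices have no common neighbour; they are then adjacent.
  mixedType-zero : ∀ t → mixedType t ≡ 0 → Z₁ t ≡ true
  mixedType-zero t isZero = by-class (t % 4 ≟ 2)
    where
    by-class : Dec (t % 4 ≡ 2) → Z₁ t ≡ true
    by-class (yes t%4≡2) = trans (Z₁-at {t} t%4≡2) (dec-true (t ≋? p₂) (mod-≡ (begin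
        t % N   ≡⟨ %N≡%4 h≡0 t ⟩
        t % 4   ≡⟨ t%4≡2 ⟩
        2       ≡⟨ [m+kn]%n≡m (h * 2) 2<4 ⟨
        p₂ % 4  ≡⟨ %N≡%4 h≡0 p₂ ⟨
        p₂ % N  ∎)))
      where
      open ≡-Reasoning
      h≡0 = 2[k∸1]≡0⇒h≡0 (trans (sym (mixedType-special t t%4≡2)) isZero)
    by-class (no  t%4≢2) = ⊥-elim (1+n≢0 (trans (sym (mixedType-generic t t%4≢2)) isZero))

  commonCount-values : ∀ a i a' i' → ¬ (a ≡ a' × i ≋ i') → DezaValue (commonCount a i a' i')
  commonCount-values false i false i' distinct = subst DezaValue (sym (commonCount-rotations i i'))
    (sameType-values (i ⊖ i') (λ i⊖i'≋0 → distinct (refl , ⊖≋0⇒≋ i⊖i'≋0)))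
  commonCount-values true i true i' distinct = subst DezaValue (sym (commonCount-reflections i i'))
    (sameType-values (i' ⊖ i) (λ i'⊖i≋0 → distinct (refl , ≋-sym (⊖≋0⇒≋ i'⊖i≋0))))
  commonCount-values false i true i' _ = subst DezaValue (sym (commonCount-mixed i i')) (mixedType-values (i' ⊖ i))
  commonCount-values true i false i' _ = subst DezaValue (sym (trans (commonCount-sym true i false i') (commonCount-mixed i' i)))
    (mixedType-values (i ⊖ i'))

  adjacent-or-commonCount≢0 : ∀ a i a' i' → ¬ (a ≡ a' × i ≋ i') → nbr a i a' i' ≡ true ⊎ commonCount a i a' i' ≢ 0
  adjacent-or-commonCount≢0 false i false i' distinct = inj₂ (λ isZero →
    sameType-nonzero (i ⊖ i') (λ i⊖i'≋0 → distinct (refl , ⊖≋0⇒≋ i⊖i'≋0)) (trans (sym (commonCount-rotations i i')) isZero))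
  adjacent-or-commonCount≢0 true i true i' distinct = inj₂ (λ isZero →
    sameType-nonzero (i' ⊖ i) (λ i'⊖i≋0 → distinct (refl , ≋-sym (⊖≋0⇒≋ i'⊖i≋0))) (trans (sym (commonCount-reflections i i')) isZero))
  adjacent-or-commonCount≢0 false i true i' _ with mixedType (i' ⊖ i) ≟ 0
  ... | yes isZero = inj₁ (mixedType-zero (i' ⊖ i) isZero)
  ... | no  nonZero = inj₂ (λ isZero → nonZero (trans (sym (commonCount-mixed i i')) isZero))
  adjacent-or-commonCount≢0 true i false i' _ with mixedType (i ⊖ i') ≟ 0
  ... | yes isZero = inj₁ (mixedType-zero (i ⊖ i') isZero)
  ... | no  nonZero = inj₂ (λ isZero → nonZero (trans (sym (commonCount-mixed i' i)) (trans (sym (commonCount-sym true i false i')) isZero)))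

  p₂%4≡2 : p₂ % 4 ≡ 2
  p₂%4≡2 = [m+kn]%n≡m (h * 2) 2<4

  nbr-0-1 : nbr false 0 false 1 ≡ false
  nbr-0-1 = Z₀-invariant (+-⊖-cancelʳ 1 0)

  nbr-0-2 : nbr false 0 false 2 ≡ true
  nbr-0-2 = Z₀-invariant (+-⊖-cancelʳ 2 0)

  nbr-0-p₂ : nbr false 0 true p₂ ≡ true
  nbr-0-p₂ = trans (Z₁-invariant {p₂ ⊖ 0} {p₂} (≋-sym (⊖-unique (≋-reflexive (+-identityʳ p₂)))))
                   (trans (Z₁-class₂ h*2<k) (dec-true (h * 2 ≟ h * 2) refl))

  commonCount-0-2 : commonCount false 0 false 2 ≡ 2
  commonCount-0-2 = trans (commonCount-rotations 0 2) (sameType-generic (0 ⊖ 2) (λ class≡0 → 1+n≢0 (trans (sym (⊖-%4 0 2)) class≡0)))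

  commonCount-0-p₂ : commonCount false 0 true p₂ ≡ 2 * (k ∸ 1)
  commonCount-0-p₂ = trans (commonCount-mixed 0 p₂)
    (mixedType-special (p₂ ⊖ 0) (trans (⊖-%4 p₂ 0) (cong (λ σ → (σ + 4) % 4) p₂%4≡2)))

module CayleyGraph (h : ℕ) where

  open ConnectionSet h
  open Dihedral k using (G; modN; _·_; _⁻¹; _^_; x; y; A₁; Z; elements; _≟G_; CayAdj; Σ-graph)

  toℕ-modN : ∀ m → toℕ (modN m) ≋ m
  toℕ-modN m = mod-≡ (trans (cong (_% N) (toℕ-fromℕ< (m%n<n m N))) (m%n%n≡m%n m N))

  ≡-from-≋ : ∀ {b b' : Bool} {i i' : Fin N} → b ≡ b' → toℕ i ≋ toℕ i' → _≡_ {A = G} (b , i) (b' , i')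
  ≡-from-≋ refl i≋i' = cong (_ ,_) (toℕ-injective (≋⇒≡ (toℕ<n _) (toℕ<n _) i≋i'))

  ∈Zᵇ : G → Bool
  ∈Zᵇ (b , m) = inZ b (toℕ m)

  ∈Zᵇ-modN : ∀ b m → ∈Zᵇ (b , modN m) ≡ inZ b m
  ∈Zᵇ-modN b m = inZ-invariant b (toℕ-modN m)

  nbrᴳ : G → G → Bool
  nbrᴳ (a , i) (b , j) = nbr a (toℕ i) b (toℕ j)

  _/ᴳ_ : G → G → G
  (b , j) /ᴳ (false , i) = (b , modN (toℕ j ⊖ toℕ i))
  (b , j) /ᴳ (true  , i) = (not b , modN (toℕ i ⊖ toℕ j))

  ∈Zᵇ-/ᴳ : ∀ g h → ∈Zᵇ (h /ᴳ g) ≡ nbrᴳ g h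
  ∈Zᵇ-/ᴳ (false , i) (b , j) = ∈Zᵇ-modN b (toℕ j ⊖ toℕ i)
  ∈Zᵇ-/ᴳ (true  , i) (b , j) = ∈Zᵇ-modN (not b) (toℕ i ⊖ toℕ j)

  ⊖-toℕ-modN : ∀ i m → i + (N ∸ toℕ (modN m)) ≋ i ⊖ m
  ⊖-toℕ-modN i m = ≋-reflexive (cong (λ r → i + (N ∸ r)) (toℕ-fromℕ< (m%n<n m N)))

  /ᴳ-· : ∀ g h → (h /ᴳ g) · g ≡ h
  /ᴳ-· (false , i) (b , j) = ≡-from-≋ (xor-identityʳ b) (begin
    toℕ (modN (toℕ (modN (toℕ j ⊖ toℕ i)) + toℕ i)) ≈⟨ toℕ-modN (toℕ (modN (toℕ j ⊖ toℕ i)) + toℕ i) ⟩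
    toℕ (modN (toℕ j ⊖ toℕ i)) + toℕ i             ≈⟨ +-≋-cong (toℕ-modN (toℕ j ⊖ toℕ i)) (≋-refl {toℕ i}) ⟩
    toℕ j ⊖ toℕ i + toℕ i                          ≈⟨ ⊖-+ (toℕ j) (toℕ i) ⟩
    toℕ j                                          ∎)
    where open import Relation.Binary.Reasoning.Setoid ≋-setoid
  /ᴳ-· (true , i) (b , j) = ≡-from-≋ (trans (xor-comm (not b) true) (not-involutive b)) (begin
    toℕ (modN (toℕ i + (N ∸ toℕ (modN (toℕ i ⊖ toℕ j))))) ≈⟨ toℕ-modN (toℕ i + (N ∸ toℕ (modN (toℕ i ⊖ toℕ j)))) ⟩
    toℕ i + (N ∸ toℕ (modN (toℕ i ⊖ toℕ j)))             ≈⟨ ⊖-toℕ-modN (toℕ i) (toℕ i ⊖ toℕ j) ⟩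
    toℕ i ⊖ (toℕ i ⊖ toℕ j)                              ≈⟨ ⊖-involutive (toℕ i) (toℕ j) ⟩
    toℕ j                                                ∎)
    where open import Relation.Binary.Reasoning.Setoid ≋-setoid

  ·-/ᴳ : ∀ s g → (s · g) /ᴳ g ≡ s
  ·-/ᴳ (sb , m) (false , i) = ≡-from-≋ (xor-identityʳ sb) (begin
    toℕ (modN (toℕ (modN (toℕ m + toℕ i)) ⊖ toℕ i)) ≈⟨ toℕ-modN (toℕ (modN (toℕ m + toℕ i)) ⊖ toℕ i) ⟩
    toℕ (modN (toℕ m + toℕ i)) ⊖ toℕ i             ≈⟨ ⊖-cong (toℕ-modN (toℕ m + toℕ i)) (≋-refl {toℕ i}) ⟩
    toℕ m + toℕ i ⊖ toℕ i                          ≈⟨ +-⊖-cancelʳ (toℕ m) (toℕ i) ⟩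
    toℕ m                                          ∎)
    where open import Relation.Binary.Reasoning.Setoid ≋-setoid
  ·-/ᴳ (sb , m) (true , i) = ≡-from-≋ (trans (cong not (xor-comm sb true)) (not-involutive sb)) (begin
    toℕ (modN (toℕ i ⊖ toℕ (modN (toℕ i + (N ∸ toℕ m))))) ≈⟨ toℕ-modN (toℕ i ⊖ toℕ (modN (toℕ i + (N ∸ toℕ m)))) ⟩
    toℕ i ⊖ toℕ (modN (toℕ i + (N ∸ toℕ m)))             ≈⟨ ⊖-cong (≋-refl {toℕ i}) (toℕ-modN (toℕ i + (N ∸ toℕ m))) ⟩
    toℕ i ⊖ (toℕ i + (N ∸ toℕ m))                        ≡⟨ cong (λ r → toℕ i ⊖ (toℕ i + (N ∸ r))) (m<n⇒m%n≡m (toℕ<n m)) ⟨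
    toℕ i ⊖ (toℕ i ⊖ toℕ m)                              ≈⟨ ⊖-involutive (toℕ i) (toℕ m) ⟩
    toℕ m                                                ∎)
    where open import Relation.Binary.Reasoning.Setoid ≋-setoid

  toℕ-modN-< : ∀ {m} → m < N → toℕ (modN m) ≡ m
  toℕ-modN-< {m} m<N = trans (toℕ-fromℕ< (m%n<n m N)) (m<n⇒m%n≡m m<N)

  1<N : 1 < N
  1<N = ρ+q*4<N {1} {0} 1<4 (s≤s z≤n)

  2<N : 2 < N
  2<N = ρ+q*4<N {2} {0} 2<4 (s≤s z≤n)

  rotation-· : ∀ a b → (false , modN a) · (false , modN b) ≡ (false , modN (a + b))
  rotation-· a b = ≡-from-≋ refl (begin
    toℕ (modN (toℕ (modN a) + toℕ (modN b))) ≈⟨ toℕ-modN (toℕ (modN a) + toℕ (modN b)) ⟩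
    toℕ (modN a) + toℕ (modN b)              ≈⟨ +-≋-cong (toℕ-modN a) (toℕ-modN b) ⟩
    a + b                                    ≈⟨ toℕ-modN (a + b) ⟨
    toℕ (modN (a + b))                       ∎)
    where open import Relation.Binary.Reasoning.Setoid ≋-setoid

  rotation-^ : ∀ a n → (false , modN a) ^ n ≡ (false , modN (n * a))
  rotation-^ a zero    = refl
  rotation-^ a (suc n) = trans (cong ((false , modN a) ·_) (rotation-^ a n)) (rotation-· a (n * a))

  x^ : ∀ n → x ^ n ≡ (false , modN n)
  x^ n = trans (rotation-^ 1 n) (cong (λ m → false , modN m) (*-identityʳ n))

  x⁴^ : ∀ j → (x ^ 4) ^ j ≡ (false , modN (j * 4))
  x⁴^ j = trans (cong (_^ j) (x^ 4)) (rotation-^ 4 j)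

  y·rotation : ∀ i → y · (false , i) ≡ (true , i)
  y·rotation i = ≡-from-≋ refl (toℕ-modN (toℕ i))

  x²·x⁴^ : ∀ j → (x ^ 2) · ((x ^ 4) ^ j) ≡ (false , modN (2 + j * 4))
  x²·x⁴^ j = trans (cong₂ _·_ (x^ 2) (x⁴^ j)) (rotation-· 2 (j * 4))

  y·x⁴^ : ∀ j → y · ((x ^ 4) ^ j) ≡ (true , modN (j * 4))
  y·x⁴^ j = trans (cong (y ·_) (x⁴^ j)) (y·rotation (modN (j * 4)))

  y·x^[2k-1] : y · (x ^ (2 * k ∸ 1)) ≡ (true , modN p₁)
  y·x^[2k-1] = trans (cong (y ·_) (x^ (2 * k ∸ 1))) (trans (y·rotation _) (cong (λ m → true , modN m) (lemma h)))
    where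
    lemma : ∀ h → h * 2 + suc (h * 2 + 0) ≡ 1 + h * 4
    lemma = solve-∀

  y·x⁻² : y · ((x ^ 2) ⁻¹) ≡ (true , modN p₂)
  y·x⁻² = trans (cong (λ g → y · (g ⁻¹)) (x^ 2))
                (trans (y·rotation _) (trans (cong (λ m → true , modN (N ∸ m)) (toℕ-modN-< 2<N)) (cong (λ m → true , modN m) N∸2≡p₂)))
    where
    lemma : ∀ h → 4 * suc (h * 2) ≡ 2 + h * 2 * 4 + 2
    lemma = solve-∀
    N∸2≡p₂ : N ∸ 2 ≡ p₂
    N∸2≡p₂ = trans (cong (_∸ 2) (lemma h)) (m+n∸n≡m p₂ 2)

  y·x⁻¹ : y · (x ⁻¹) ≡ (true , modN p₃)
  y·x⁻¹ = trans (y·rotation _) (trans (cong (λ m → true , modN (N ∸ m)) (toℕ-modN-< 1<N)) (cong (λ m → true , modN m) N∸1≡p₃))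
    where
    lemma : ∀ h → 4 * suc (h * 2) ≡ 3 + h * 2 * 4 + 1
    lemma = solve-∀
    N∸1≡p₃ : N ∸ 1 ≡ p₃
    N∸1≡p₃ = trans (cong (_∸ 1) (lemma h)) (m+n∸n≡m p₃ 1)

  x^[2[k-1]] : x ^ (2 * (k ∸ 1)) ≡ (false , modN c)
  x^[2[k-1]] = trans (x^ (2 * (k ∸ 1))) (cong (λ m → false , modN m) (lemma h))
    where
    lemma : ∀ h → 2 * (h * 2) ≡ h * 4
    lemma = solve-∀

  ∈A₁⁻ : ∀ {a} → a ∈ A₁ → ∃ λ j → j < k × a ≡ (x ^ 4) ^ j
  ∈A₁⁻ a∈A₁ = let (j , j∈upTo , a≡) = ∈-map⁻ (λ j → (x ^ 4) ^ j) a∈A₁ in j , ∈-upTo⁻ j∈upTo , a≡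

  ∈A₁⁺ : ∀ {j} → j < k → (x ^ 4) ^ j ∈ A₁
  ∈A₁⁺ j<k = ∈-map⁺ (λ j → (x ^ 4) ^ j) (∈-upTo⁺ j<k)

  excluded? : ∀ a → Dec (¬ a ≡ x ^ (2 * (k ∸ 1)))
  excluded? a = ¬? (a ≟G (x ^ (2 * (k ∸ 1))))

  x⁴^-excluded : ∀ {j} → j < k → (x ^ 4) ^ j ≡ x ^ (2 * (k ∸ 1)) → j ≡ h
  x⁴^-excluded {j} j<k eq = *-cancelʳ-≡ j h 4 (≋⇒≡ (ρ+q*4<N 0<4 j<k) (ρ+q*4<N 0<4 h<k) (begin
    j * 4                              ≈⟨ toℕ-modN (j * 4) ⟨
    toℕ (modN (j * 4))                 ≡⟨ cong (toℕ ∘ proj₂) (trans (sym (x⁴^ j)) (trans eq x^[2[k-1]])) ⟩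
    toℕ (modN c)                       ≈⟨ toℕ-modN c ⟩
    c                                  ∎))
    where open import Relation.Binary.Reasoning.Setoid ≋-setoid

  ∈Z⇒∈Zᵇ : ∀ {s} → s ∈ Z → ∈Zᵇ s ≡ true
  ∈Z⇒∈Zᵇ {s} s∈Z = [ in-x²A₁ , [ in-yA₁ , in-rest ]′ ∘ ∈-++⁻ (map (y ·_) (filter excluded? A₁)) ]′
                      (∈-++⁻ (map ((x ^ 2) ·_) A₁) s∈Z)
    where
    in-x²A₁ : s ∈ map ((x ^ 2) ·_) A₁ → ∈Zᵇ s ≡ true
    in-x²A₁ s∈ = let (a , a∈A₁ , s≡) = ∈-map⁻ ((x ^ 2) ·_) s∈
                     (j , _ , a≡) = ∈A₁⁻ a∈A₁
                 in trans (cong ∈Zᵇ (trans s≡ (trans (cong ((x ^ 2) ·_) a≡) (x²·x⁴^ j))))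
                          (trans (∈Zᵇ-modN false (2 + j * 4)) (Z₀-class j 2<4))
    in-yA₁ : s ∈ map (y ·_) (filter excluded? A₁) → ∈Zᵇ s ≡ true
    in-yA₁ s∈ = let (a , a∈filter , s≡) = ∈-map⁻ (y ·_) s∈
                    (a∈A₁ , a≢excluded) = ∈-filter⁻ excluded? {xs = A₁} a∈filter
                    (j , j<k , a≡) = ∈A₁⁻ a∈A₁
                in trans (cong ∈Zᵇ (trans s≡ (trans (cong (y ·_) a≡) (y·x⁴^ j))))
                         (trans (∈Zᵇ-modN true (j * 4)) (trans (Z₁-class₀ j<k)
                           (cong not (dec-false (j ≟ h) (λ j≡h → a≢excluded (trans a≡ (trans (cong ((x ^ 4) ^_) j≡h) (trans (x⁴^ h) (sym x^[2[k-1]])))))))))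
    in-rest : s ∈ (y · (x ^ (2 * k ∸ 1))) ∷ (y · ((x ^ 2) ⁻¹)) ∷ (y · (x ⁻¹)) ∷ [] → ∈Zᵇ s ≡ true
    in-rest (here s≡) =
      trans (cong ∈Zᵇ (trans s≡ y·x^[2k-1])) (trans (∈Zᵇ-modN true p₁) (trans (Z₁-class₁ h<k) (dec-true (h ≟ h) refl)))
    in-rest (there (here s≡)) =
      trans (cong ∈Zᵇ (trans s≡ y·x⁻²)) (trans (∈Zᵇ-modN true p₂) (trans (Z₁-class₂ h*2<k) (dec-true (h * 2 ≟ h * 2) refl)))
    in-rest (there (there (here s≡))) =
      trans (cong ∈Zᵇ (trans s≡ y·x⁻¹)) (trans (∈Zᵇ-modN true p₃) (trans (Z₁-class₃ h*2<k) (dec-true (h * 2 ≟ h * 2) refl)))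

  residue-decomposition : ∀ (m : Fin N) {σ} → toℕ m % 4 ≡ σ → ∃ λ q → q < k × toℕ m ≡ σ + q * 4
  residue-decomposition m {σ} m%4≡σ = toℕ m / 4 , m<n*o⇒m/o<n (subst (toℕ m <_) N≡k*4 (toℕ<n m)) ,
    trans (m≡m%n+[m/n]*n (toℕ m) 4) (cong (_+ toℕ m / 4 * 4) m%4≡σ)

  ≡-modN : ∀ {b} {m : Fin N} {r} → toℕ m ≋ r → _≡_ {A = G} (b , m) (b , modN r)
  ≡-modN {r = r} m≋r = ≡-from-≋ refl (≋-trans m≋r (≋-sym (toℕ-modN r)))

  ∈Zᵇ⇒∈Z : ∀ s → ∈Zᵇ s ≡ true → s ∈ Z
  ∈Zᵇ⇒∈Z (false , m) s∈Zᵇ = subst (_∈ Z) (sym (trans (≡-modN (≋-reflexive m≡)) (sym (x²·x⁴^ q))))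
                                   (∈-++⁺ˡ (∈-map⁺ ((x ^ 2) ·_) (∈A₁⁺ q<k)))
    where
    decomposition = residue-decomposition m (does⇒ (toℕ m % 4 ≟ 2) s∈Zᵇ)
    q   = proj₁ decomposition
    q<k = proj₁ (proj₂ decomposition)
    m≡  = proj₂ (proj₂ decomposition)
  ∈Zᵇ⇒∈Z (true , m) s∈Zᵇ = by-class (toℕ m % 4) refl s∈Zᵇ
    where
    rest : ∀ {s} → s ∈ map (y ·_) (filter excluded? A₁) ++ (y · (x ^ (2 * k ∸ 1))) ∷ (y · ((x ^ 2) ⁻¹)) ∷ (y · (x ⁻¹)) ∷ [] → s ∈ Z
    rest = ∈-++⁺ʳ (map ((x ^ 2) ·_) A₁)
    by-class : ∀ σ → toℕ m % 4 ≡ σ → Z₁-on-class σ (toℕ m) ≡ true → (true , m) ∈ Z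
    by-class 0 m%4≡0 m≉c = subst (_∈ Z) (sym (trans (≡-modN (≋-reflexive m≡)) (sym (y·x⁴^ q))))
                              (rest (∈-++⁺ˡ (∈-map⁺ (y ·_) (∈-filter⁺ excluded? (∈A₁⁺ q<k) not-excluded))))
      where
      decomposition = residue-decomposition m m%4≡0
      q   = proj₁ decomposition
      q<k = proj₁ (proj₂ decomposition)
      m≡  = proj₂ (proj₂ decomposition)
      not-excluded : ¬ (x ^ 4) ^ q ≡ x ^ (2 * (k ∸ 1))
      not-excluded eq = not-¬ (sym (dec-true (toℕ m ≋? c) (≋-reflexive (trans m≡ (cong (_* 4) (x⁴^-excluded q<k eq)))))) (sym m≉c)
    by-class 1 _ m≋p₁ = rest (∈-++⁺ʳ _ (here (trans (≡-modN (does⇒ (toℕ m ≋? p₁) m≋p₁)) (sym y·x^[2k-1]))))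
    by-class 2 _ m≋p₂ = rest (∈-++⁺ʳ _ (there (here (trans (≡-modN (does⇒ (toℕ m ≋? p₂) m≋p₂)) (sym y·x⁻²)))))
    by-class (suc (suc (suc _))) _ m≋p₃ = rest (∈-++⁺ʳ _ (there (there (here (trans (≡-modN (does⇒ (toℕ m ≋? p₃) m≋p₃)) (sym y·x⁻¹))))))

  Adj : G → G → Set
  Adj = CayAdj Z

  nbrᴳ-sym : ∀ g h → nbrᴳ g h ≡ nbrᴳ h g
  nbrᴳ-sym (a , i) (b , j) = nbr-sym a (toℕ i) b (toℕ j)

  quotient∈Z⇒nbr : ∀ g h {s} → s ∈ Z → h ≡ s · g → nbrᴳ g h ≡ true
  quotient∈Z⇒nbr g h {s} s∈Z h≡s·g = trans (sym (∈Zᵇ-/ᴳ g h))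
    (subst (λ s′ → ∈Zᵇ s′ ≡ true) (trans (sym (·-/ᴳ s g)) (cong (_/ᴳ g) (sym h≡s·g))) (∈Z⇒∈Zᵇ s∈Z))

  Adj⇒nbr : ∀ g h → Adj g h → nbrᴳ g h ≡ true
  Adj⇒nbr g h (inj₁ any) = let (s , s∈Z , h≡s·g) = find any in quotient∈Z⇒nbr g h s∈Z h≡s·g
  Adj⇒nbr g h (inj₂ any) = let (s , s∈Z , g≡s·h) = find any in trans (nbrᴳ-sym g h) (quotient∈Z⇒nbr h g s∈Z g≡s·h)

  nbr⇒Adj : ∀ g h → nbrᴳ g h ≡ true → Adj g h
  nbr⇒Adj g h nbr≡true = inj₁ (lose (∈Zᵇ⇒∈Z (h /ᴳ g) (trans (∈Zᵇ-/ᴳ g h) nbr≡true)) (sym (/ᴳ-· g h)))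

  does-adj? : ∀ g h → does (FinGraph.adj? Σ-graph g h) ≡ nbrᴳ g h
  does-adj? g h = trans (does-⇔ (mk⇔ (Adj⇒nbr g h) (nbr⇒Adj g h)) (FinGraph.adj? Σ-graph g h) (nbrᴳ g h ≟ᵇ true))
                        (does[b≟true]≡b (nbrᴳ g h))

  part : Bool → List G
  part b = map (b ,_) (allFin N)

  length-filter-elements : ∀ {ℓ} {P : Pred G ℓ} (P? : Decidable P) (f : Bool → ℕ → Bool) →
    (∀ b i → does (P? (b , i)) ≡ f b (toℕ i)) → length (filter P? elements) ≡ count N (f false) + count N (f true)
  length-filter-elements P? f does≡f = begin
    length (filter P? (part false ++ part true))          ≡⟨ cong length (filter-++ P? (part false) (part true)) ⟩
    length (filter P? (part false) ++ filter P? (part true)) ≡⟨ length-++ (filter P? (part false)) ⟩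
    length (filter P? (part false)) + length (filter P? (part true)) ≡⟨ cong₂ _+_ (count-part false) (count-part true) ⟩
    count N (f false) + count N (f true)                  ∎
    where
    open ≡-Reasoning
    count-part : ∀ b → length (filter P? (part b)) ≡ count N (f b)
    count-part b = trans (cong (length ∘ filter P?) (map-tabulate (λ i → i) (_,_ {B = λ _ → Fin N} b)))
                         (length-filter-tabulate P? N (b ,_) (f b) (does≡f b))

  order-Σ : order Σ-graph ≡ 8 * k
  order-Σ = begin
    length (part false ++ part true)               ≡⟨ length-++ (part false) ⟩
    length (part false) + length (part true)      ≡⟨ cong₂ _+_ (size false) (size true) ⟩
    N + N                                                            ≡⟨ lemma k ⟩
    8 * k                                                            ∎
    where
    open ≡-Reasoning
    lemma : ∀ k → 4 * k + 4 * k ≡ 8 * k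
    lemma = solve-∀
    size : ∀ b → length (part b) ≡ N
    size b = trans (length-map (b ,_) (allFin N)) (length-tabulate (λ i → i))

  degree-Σ : ∀ v → degree Σ-graph v ≡ 2 * (k + 1)
  degree-Σ (a , i) = trans (length-filter-elements (FinGraph.adj? Σ-graph (a , i)) (nbr a (toℕ i)) (λ b j → does-adj? (a , i) (b , j)))
                           (degreeCount-value a (toℕ i))

  common-Σ : ∀ a i a' i' → common Σ-graph (a , i) (a' , i') ≡ commonCount a (toℕ i) a' (toℕ i')
  common-Σ a i a' i' = length-filter-elements _ (λ b j → nbr a (toℕ i) b j ∧ nbr a' (toℕ i') b j)
    (λ b j → cong₂ _∧_ (does-adj? (a , i) (b , j)) (does-adj? (a' , i') (b , j)))

  distinct-residues : ∀ {a a' : Bool} {i i' : Fin N} → _≢_ {A = G} (a , i) (a' , i') → ¬ (a ≡ a' × toℕ i ≋ toℕ i')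
  distinct-residues u≢v (a≡a' , i≋i') = u≢v (≡-from-≋ a≡a' i≋i')

  common-Σ-values : ∀ u v → u ≢ v → common Σ-graph u v ≡ 2 * (k ∸ 1) ⊎ common Σ-graph u v ≡ 2
  common-Σ-values (a , i) (a' , i') u≢v =
    subst DezaValue (sym (common-Σ a i a' i')) (commonCount-values a (toℕ i) a' (toℕ i') (distinct-residues u≢v))

  Adj-sym : ∀ g h → Adj g h → Adj h g
  Adj-sym g h = swap

  Σ-distance≤2 : ∀ u v → u ≢ v → Adj u v ⊎ ∃ λ w → Adj u w × Adj w v
  Σ-distance≤2 u@(a , i) v@(a' , i') u≢v =
    [ (λ adjacent → inj₁ (nbr⇒Adj u v adjacent)) , (λ common≢0 → inj₂ (common-neighbour common≢0)) ]′
      (adjacent-or-commonCount≢0 a (toℕ i) a' (toℕ i') (distinct-residues u≢v))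
    where
    common-neighbour : commonCount a (toℕ i) a' (toℕ i') ≢ 0 → ∃ λ w → Adj u w × Adj w v
    common-neighbour common≢0 =
      let (w , u~w , v~w) = ∃-from-length-filter (λ w → FinGraph.adj? Σ-graph u w ×-dec FinGraph.adj? Σ-graph v w) elements
                              (λ common≡0 → common≢0 (trans (sym (common-Σ a i a' i')) common≡0))
      in w , u~w , Adj-sym v w v~w

  vertex : Bool → ∀ r → r < N → G
  vertex b r r<N = b , fromℕ< r<N

  common-vertex : ∀ a r a' r' (r<N : r < N) (r'<N : r' < N) → common Σ-graph (vertex a r r<N) (vertex a' r' r'<N) ≡ commonCount a r a' r'
  common-vertex a r a' r' r<N r'<N = trans (common-Σ a _ a' _) (cong₂ (λ i i' → commonCount a i a' i') (toℕ-fromℕ< r<N) (toℕ-fromℕ< r'<N))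

  nbr-vertex : ∀ a r a' r' (r<N : r < N) (r'<N : r' < N) → nbrᴳ (vertex a r r<N) (vertex a' r' r'<N) ≡ nbr a r a' r'
  nbr-vertex a r a' r' r<N r'<N = cong₂ (λ i i' → nbr a i a' i') (toℕ-fromℕ< r<N) (toℕ-fromℕ< r'<N)

  vertex-≢ : ∀ {a a' r r'} (r<N : r < N) (r'<N : r' < N) → r ≢ r' → vertex a r r<N ≢ vertex a' r' r'<N
  vertex-≢ r<N r'<N r≢r' eq = r≢r' (trans (sym (toℕ-fromℕ< r<N)) (trans (cong (toℕ ∘ proj₂) eq) (toℕ-fromℕ< r'<N)))

  0<N : 0 < N
  0<N = s≤s z≤n

  p₂<N : p₂ < N
  p₂<N = ρ+q*4<N 2<4 h*2<k

  Σ-not-strongly-regular : ¬ StronglyRegular Σ-graph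
  Σ-not-strongly-regular (_ , λ′ , _ , _ , adjacent-common , _) = 2[k∸1]≢2 (begin
    2 * (k ∸ 1)                 ≡⟨ commonCount-0-p₂ ⟨
    commonCount false 0 true p₂ ≡⟨ common-vertex false 0 true p₂ 0<N p₂<N ⟨
    common Σ-graph u₀ v₂        ≡⟨ adjacent-common u₀ v₂ (λ ()) (nbr⇒Adj u₀ v₂ (trans (nbr-vertex false 0 true p₂ 0<N p₂<N) nbr-0-p₂)) ⟩
    λ′                          ≡⟨ adjacent-common u₀ v₁ (vertex-≢ 0<N 2<N (λ ())) (nbr⇒Adj u₀ v₁ (trans (nbr-vertex false 0 false 2 0<N 2<N) nbr-0-2)) ⟨
    common Σ-graph u₀ v₁        ≡⟨ common-vertex false 0 false 2 0<N 2<N ⟩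
    commonCount false 0 false 2 ≡⟨ commonCount-0-2 ⟩
    2                           ∎)
    where
    open ≡-Reasoning
    u₀ v₁ v₂ : G
    u₀ = vertex false 0 0<N
    v₁ = vertex false 2 2<N
    v₂ = vertex true p₂ p₂<N

  Σ-diameter-2 : Diameter2 Σ-graph
  Σ-diameter-2 = Σ-distance≤2 , vertex false 0 0<N , vertex false 1 1<N , vertex-≢ 0<N 1<N (λ ()) , non-adjacent
    where
    non-adjacent : ¬ Adj (vertex false 0 0<N) (vertex false 1 1<N)
    non-adjacent adj with () ← trans (sym (trans (nbr-vertex false 0 false 1 0<N 1<N) nbr-0-1))
                                      (Adj⇒nbr (vertex false 0 0<N) (vertex false 1 1<N) adj)

  Σ-strictly-Deza : StrictlyDezaWith Σ-graph (8 * k) (2 * (k + 1)) (2 * (k ∸ 1)) 2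
  Σ-strictly-Deza = (order-Σ , degree-Σ , common-Σ-values) , Σ-not-strongly-regular , Σ-diameter-2

odd-Σ-strictly-Deza : ∀ k .{{_ : NonZero k}} h → k ≡ suc (h * 2) →
  StrictlyDezaWith (Dihedral.Σ-graph k) (8 * k) (2 * (k + 1)) (2 * (k ∸ 1)) 2
odd-Σ-strictly-Deza .(suc (h * 2)) h refl = CayleyGraph.Σ-strictly-Deza h

lemma5p1 : (k : ℕ) .{{_ : NonZero k}} → k % 2 ≡ 1 →
    StrictlyDezaWith (Dihedral.Σ-graph k) (8 * k) (2 * (k + 1)) (2 * (k ∸ 1)) 2
lemma5p1 k k-odd = odd-Σ-strictly-Deza k (k / 2) (trans (m≡m%n+[m/n]*n k 2) (cong (_+ k / 2 * 2) k-odd))
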